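{- Let $(G,T;A,B)$ be a comb and $F$ a minimum join. Let $G_0\in\mathcal{G}(G,T)$ and let $\langle X,P\rangle$ be a guide for $V(G_0)$ associated with $F$. Let $Q$ be an effectively $F$-balanced ear relative to $X$ with $V(Q)\cap V(G_0)=\emptyset$. Then $\langle X\cup V(Q),P\rangle$ is a guide for $V(G_0)$ associated with $F$.
   Context: Graphs are finite, possibly with multiple edges. A join of $(G,T)$ is $F\subseteq E(G)$ with $|\delta_G(v)\cap F|$ odd iff $v\in T$; $(G,T)$ is a graft if each component has evenly many vertices of $T$; $\nu(G,T)$ is the minimum join size. $(G,T;A,B)$ denotes a bipartite graft with ordered color classes $A,B$; comb: $B\subseteq T$ and $\nu(G,T)=|B|$. $w_F(e)=-1$ for $e\in F$, $1$ otherwise; $F$-weight of a subgraph = sum over its edges. Allowed edges lie in some minimum join; factor-components are maximal subgrafts whose vertices are pairwise connected by paths of allowed edges; $\mathcal{G}(G,T)$ is their set. Ears relative to $Z\subseteq V(G)$: a subgraph $P$ with $E(P)\ne\emptyset$ that is either a path whose non-end vertices avoid $Z$ with ends in $Z$, or a circuit meeting $Z$ in exactly one vertex (round ears), or a path one of whose ends is its only vertex in $Z$ (straight ears). Bonds: vertices of $P$ in $Z$; $\mathrm{int}(P)$: other vertices; necks: edges of $P$ between $Z$ and $\mathrm{int}(P)$. A path with ends $s,t$ is $F$-balanced if $|\delta_P(v)\cap F|=1$ for all $v\in(V(P)\cap B)\setminus\{s,t\}$; an ear is $F$-balanced if this holds for all $v\in\mathrm{int}(P)\cap B$; an $F$-balanced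 ear is effectively $F$-balanced if it is round, or straight with $F\cap E(P)$ a perfect matching of $P-(\{s\}\cap A)-(\{t\}\cap B)$, $t$ being the bond and $s$ the other end. A guide for $X_0\subseteq V(G)$ associated with $F$ is a pair $\langle X,P\rangle$ with: $X\subseteq V(G)\setminus X_0$; $P$ an $F$-balanced ear relative to $X_0$ whose bonds lie in $B\cap X_0$ and whose necks are not in $F$; $\mathrm{int}(P)\subseteq X$; for each $x\in X$ an $F$-balanced path $R$ between $x$ and a bond $y$ of $P$ with $V(R)\setminus\{y\}\subseteq X$ and $w_F(R)\in\{0,1\}$. -}

module Defs where

open import Data.Nat using (ℕ; zero; suc; _≤_)
open import Data.Nat.Divisibility using (_∣_)
open import Data.Integer using (ℤ; +_; _-_)
open import Data.Fin using (Fin; inject₁; fromℕ; _≟_)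
open import Data.Fin.Subset using (Subset; _∈_; _∉_; _⊆_; _∩_; _∪_; ∁; ∣_∣; Nonempty)
open import Data.Vec using (tabulate)
open import Data.Product using (Σ; ∃; ∃-syntax; _×_; _,_; proj₁; proj₂)
open import Data.Sum using (_⊎_)
open import Data.Bool using (_∨_)
open import Relation.Nullary using (¬_; does)
open import Relation.Binary.PropositionalEquality using (_≡_; _≢_)
open import Function.Bundles using (_⇔_)
open import Function.Definitions using (Injective)

-- Finite multigraphs: vertices Fin n, edges Fin m, each edge with a
-- (unordered, here stored as an ordered) pair of ends.

record Graph : Set where
  field
    n    : ℕ
    m    : ℕ
    ends : Fin m → Fin n × Fin n
open Graph public

module _ (G : Graph) where

  Vtx : Set
  Vtx = Fin (n G)

  Edg : Set
  Edg = Fin (m G)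

  Incident : Edg → Vtx → Set
  Incident e v = (proj₁ (ends G e) ≡ v) ⊎ (proj₂ (ends G e) ≡ v)

  Joins : Edg → Vtx → Vtx → Set
  Joins e u v = (ends G e ≡ (u , v)) ⊎ (ends G e ≡ (v , u))

  δ : Vtx → Subset (m G)
  δ v = tabulate (λ e → does (proj₁ (ends G e) ≟ v) ∨ does (proj₂ (ends G e) ≟ v))

  Odd : ℕ → Set
  Odd k = ¬ (2 ∣ k)

  IsJoin : Subset (n G) → Subset (m G) → Set
  IsJoin T F = ∀ v → Odd ∣ δ v ∩ F ∣ ⇔ v ∈ T

  MinJoin : Subset (n G) → Subset (m G) → Set
  MinJoin T F = IsJoin T F × (∀ F′ → IsJoin T F′ → ∣ F ∣ ≤ ∣ F′ ∣)

  NuIs : Subset (n G) → ℕ → Set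
  NuIs T k = (∃[ F ] (IsJoin T F × ∣ F ∣ ≡ k)) × (∀ F′ → IsJoin T F′ → k ≤ ∣ F′ ∣)

  record Sub : Set where
    constructor sub
    field
      V : Subset (n G)
      E : Subset (m G)
  open Sub public

  record IsPath (P : Sub) (s t : Vtx) : Set where
    field
      len  : ℕ
      vs   : Fin (suc len) → Vtx
      es   : Fin len → Edg
      vs-inj : Injective _≡_ _≡_ vs
      joins  : ∀ i → Joins (es i) (vs (inject₁ i)) (vs (Data.Fin.suc i))
      start  : vs Data.Fin.zero ≡ s
      finish : vs (fromℕ len) ≡ t
      V-img  : ∀ v → v ∈ V P ⇔ (∃[ i ] vs i ≡ v)
      E-img  : ∀ e → e ∈ E P ⇔ (∃[ i ] es i ≡ e)

  record IsCircuit (P : Sub) : Set where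
    field
      len  : ℕ
      len≥2 : 2 ≤ len
      vs   : Fin (suc len) → Vtx
      es   : Fin len → Edg
      closed : vs Data.Fin.zero ≡ vs (fromℕ len)
      vs-inj : Injective _≡_ _≡_ (λ i → vs (inject₁ i))
      es-inj : Injective _≡_ _≡_ es
      joins  : ∀ i → Joins (es i) (vs (inject₁ i)) (vs (Data.Fin.suc i))
      V-img  : ∀ v → v ∈ V P ⇔ (∃[ i ] vs i ≡ v)
      E-img  : ∀ e → e ∈ E P ⇔ (∃[ i ] es i ≡ e)

  PathEar : Subset (n G) → Sub → Set
  PathEar Z P = Σ Vtx λ s → Σ Vtx λ t →
    IsPath P s t × Nonempty (E P) × s ∈ Z × t ∈ Z ×
    (∀ v → v ∈ V P → v ≢ s → v ≢ t → v ∉ Z)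

  RoundEar : Subset (n G) → Sub → Set
  RoundEar Z P = IsCircuit P × Nonempty (E P) ×
    (Σ Vtx λ z → z ∈ V P × (∀ v → v ∈ V P → (v ∈ Z ⇔ v ≡ z)))

  StraightEar : Subset (n G) → Sub → Vtx → Vtx → Set
  StraightEar Z P s t = IsPath P s t × Nonempty (E P) × t ∈ Z ×
    (∀ v → v ∈ V P → v ∈ Z → v ≡ t)

  Ear : Subset (n G) → Sub → Set
  Ear Z P = PathEar Z P ⊎ RoundEar Z P ⊎ (Σ Vtx λ s → Σ Vtx λ t → StraightEar Z P s t)

  bonds : Subset (n G) → Sub → Subset (n G)
  bonds Z P = V P ∩ Z

  int : Subset (n G) → Sub → Subset (n G)
  int Z P = V P ∩ ∁ Z

  IsNeck : Subset (n G) → Sub → Edg → Set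
  IsNeck Z P e = e ∈ E P ×
    ((proj₁ (ends G e) ∈ Z × proj₂ (ends G e) ∈ int Z P) ⊎
     (proj₂ (ends G e) ∈ Z × proj₁ (ends G e) ∈ int Z P))

  degF : Subset (m G) → Sub → Vtx → ℕ
  degF F P v = ∣ δ v ∩ E P ∩ F ∣

  BalancedPath : Subset (n G) → Subset (m G) → Sub → Vtx → Vtx → Set
  BalancedPath B F P s t = IsPath P s t ×
    (∀ v → v ∈ V P → v ∈ B → v ≢ s → v ≢ t → degF F P v ≡ 1)

  BalancedEar : Subset (n G) → Subset (m G) → Subset (n G) → Sub → Set
  BalancedEar B F Z P = Ear Z P × (∀ v → v ∈ int Z P → v ∈ B → degF F P v ≡ 1)

  EffBalancedEar : Subset (n G) → Subset (n G) → Subset (m G) → Subset (n G) → Sub → Set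
  EffBalancedEar A B F Z P = BalancedEar B F Z P ×
    (RoundEar Z P ⊎
     (Σ Vtx λ s → Σ Vtx λ t → StraightEar Z P s t ×
       let Removed : Vtx → Set
           Removed r = (r ≡ s × s ∈ A) ⊎ (r ≡ t × t ∈ B)
       in
           (∀ e → e ∈ E P → e ∈ F →
              ¬ Removed (proj₁ (ends G e)) × ¬ Removed (proj₂ (ends G e))) ×
           (∀ v → v ∈ V P → ¬ Removed v → degF F P v ≡ 1)))

  wF : Subset (m G) → Sub → ℤ
  wF F P = + ∣ E P ∩ ∁ F ∣ - + ∣ E P ∩ F ∣

  Guide : Subset (n G) → Subset (m G) → Subset (n G) → Subset (n G) → Sub → Set
  Guide B F X₀ X P =
    (∀ x → x ∈ X → x ∉ X₀) ×
    BalancedEar B F X₀ P ×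
    bonds X₀ P ⊆ B ∩ X₀ ×
    (∀ e → IsNeck X₀ P e → e ∉ F) ×
    int X₀ P ⊆ X ×
    (∀ x → x ∈ X → Σ Sub λ R → Σ Vtx λ y →
       y ∈ bonds X₀ P × BalancedPath B F R x y ×
       (∀ v → v ∈ V R → v ≢ y → v ∈ X) ×
       (wF F R ≡ + 0 ⊎ wF F R ≡ + 1))

  Connected : Vtx → Vtx → Set
  Connected u v = Σ Sub λ P → IsPath P u v

  IsComponent : Subset (n G) → Set
  IsComponent C = Nonempty C × (∀ u v → u ∈ C → v ∈ C → Connected u v) ×
    (∀ u v → u ∈ C → Connected u v → v ∈ C)

  IsGraft : Subset (n G) → Set
  IsGraft T = ∀ C → IsComponent C → 2 ∣ ∣ C ∩ T ∣

  IsBipartition : Subset (n G) → Subset (n G) → Set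
  IsBipartition A B = (∀ v → (v ∈ A × v ∉ B) ⊎ (v ∈ B × v ∉ A)) ×
    (∀ e → (proj₁ (ends G e) ∈ A × proj₂ (ends G e) ∈ B) ⊎
           (proj₁ (ends G e) ∈ B × proj₂ (ends G e) ∈ A))

  IsComb : Subset (n G) → Subset (n G) → Subset (n G) → Set
  IsComb T A B = IsBipartition A B × IsGraft T × B ⊆ T × NuIs T ∣ B ∣

  Allowed : Subset (n G) → Edg → Set
  Allowed T e = Σ (Subset (m G)) λ F′ → MinJoin T F′ × e ∈ F′

  AllowedConnected : Subset (n G) → Vtx → Vtx → Set
  AllowedConnected T u v = Σ Sub λ P → IsPath P u v × (∀ e → e ∈ E P → Allowed T e)

  IsFactorComponent : Subset (n G) → Subset (n G) → Set
  IsFactorComponent T V₀ = Nonempty V₀ ×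
    (∀ u v → u ∈ V₀ → v ∈ V₀ → AllowedConnected T u v) ×
    (∀ u v → u ∈ V₀ → AllowedConnected T u v → v ∈ V₀)

{-# OPTIONS --safe #-}
-- For x ∈ X the old guide path still serves. For x ∈ V(Q) ∖ X, walk along Q to its bond z ∈ X and
-- continue along the guide path R of z. On a straight ear F ∩ E(Q) is a perfect matching of Q minus
-- its removed ends, so F-edges alternate with the colour classes and the walk leaves x ∈ B through an
-- F-edge; on a round ear one of the two directions around the circuit does. In a bipartite graph an
-- F-balanced path ending in B through a non-F edge has F-weight 1 if it starts in A, 0 if it starts
-- in B through an F-edge, and 2 otherwise. Hence R leaves z ∈ B through an F-edge, and R enters its
-- bond through a non-F edge because F-edges at a factor-component stay inside it. In a comb every
-- vertex of B meets exactly one F-edge, so the concatenation is still F-balanced at z, and the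
-- weight count shows that its F-weight is 0 or 1.
module Submission where

open import Defs
open import Data.Bool using (true; _∨_)
open import Data.Empty using (⊥; ⊥-elim)
open import Data.Fin using (Fin; zero; suc; inject₁; fromℕ; _≟_)
import Data.Fin.Properties as FinP
open import Data.Fin.Subset using (Subset; _∈_; _∉_; _∪_; _∩_; ∁; ∣_∣; ⁅_⁆; inside; outside; Nonempty; _⊆_) renaming (⊥ to ∅; ⊤ to full)
import Data.Fin.Subset.Properties as SetP
open SetP using (_∈?_)
open import Data.Integer as ℤ using (+_; _⊖_)
import Data.Integer.Properties as ℤP
open import Data.List as List using (List; []; _∷_; _++_; length)
open import Data.List.Membership.Propositional using () renaming (_∈_ to _∈ₗ_; _∉_ to _∉ₗ_)
open import Data.List.Membership.Propositional.Properties using (∈-++⁺ˡ; ∈-++⁺ʳ; ∈-++⁻; ∈-map⁺; ∈-map⁻; ∈-tabulate⁺; ∈-tabulate⁻)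
open import Data.List.Relation.Unary.Any using (here; there)
import Data.List.Relation.Unary.Any.Properties as AnyP
import Data.List.Properties as ListP
open import Data.Maybe using (Maybe; just; nothing)
open import Data.Nat using (ℕ; zero; suc; _+_; _∸_; _≤_)
open import Data.Nat.Divisibility using (_∣_; _∣0)
import Data.Nat.Properties as ℕP
open import Data.Product as Product using (Σ; ∃-syntax; _×_; _,_; proj₁; proj₂)
open import Data.Product.Properties using (,-injectiveˡ; ,-injectiveʳ)
open import Data.Sum as Sum using (_⊎_; inj₁; inj₂; [_,_]; swap)
open import Data.Unit using (⊤; tt)
open import Data.Vec using (_∷_; [])
open import Data.Vec.Base using () renaming (here to vhere; there to vthere)
import Data.Vec.Properties as VecP
open import Function using (_∘_; case_of_)
open import Function.Bundles using (_⇔_; mk⇔; Equivalence)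
open import Function.Definitions using (Injective)
open import Relation.Binary.PropositionalEquality hiding ([_])
open import Relation.Nullary using (¬_; Dec; yes; no; does)

Nodup : {A : Set} → List A → Set
Nodup []       = ⊤
Nodup (x ∷ xs) = x ∉ₗ xs × Nodup xs

module _ {A : Set} where

  nodup-++⁺ : (xs ys : List A) → Nodup xs → Nodup ys → (∀ {a} → a ∈ₗ xs → a ∉ₗ ys) → Nodup (xs ++ ys)
  nodup-++⁺ []       ys _          nys _    = nys
  nodup-++⁺ (x ∷ xs) ys (x∉ , nxs) nys disj =
    [ x∉ , disj (here refl) ] ∘ ∈-++⁻ xs , nodup-++⁺ xs ys nxs nys (disj ∘ there)

  nodup-++⁻ : (xs ys : List A) → Nodup (xs ++ ys) → Nodup xs × Nodup ys × (∀ {a} → a ∈ₗ xs → a ∉ₗ ys)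
  nodup-++⁻ []       ys nd         = tt , nd , λ ()
  nodup-++⁻ (x ∷ xs) ys (x∉ , nd) with nodup-++⁻ xs ys nd
  ... | nxs , nys , disj = (x∉ ∘ ∈-++⁺ˡ , nxs) , nys ,
    λ { (here refl) → x∉ ∘ ∈-++⁺ʳ xs ; (there a∈) → disj a∈ }

  nodup-++-comm : (xs ys : List A) → Nodup (xs ++ ys) → Nodup (ys ++ xs)
  nodup-++-comm xs ys nd with nodup-++⁻ xs ys nd
  ... | nxs , nys , disj = nodup-++⁺ ys xs nys nxs (λ a∈ys a∈xs → disj a∈xs a∈ys)

  ∈-++-comm : ∀ {a} (xs ys : List A) → a ∈ₗ xs ++ ys → a ∈ₗ ys ++ xs
  ∈-++-comm xs ys = [ ∈-++⁺ʳ ys , ∈-++⁺ˡ ] ∘ ∈-++⁻ xs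

  nodup-reverse : (xs : List A) → Nodup xs → Nodup (List.reverse xs)
  nodup-reverse []       _          = tt
  nodup-reverse (x ∷ xs) (x∉ , nd) = subst Nodup (sym (ListP.unfold-reverse x xs))
    (nodup-++⁺ (List.reverse xs) (x ∷ []) (nodup-reverse xs nd) ((λ ()) , tt)
      (λ a∈ → λ { (here refl) → x∉ (AnyP.reverse⁻ a∈) }))

  nodup-tabulate : ∀ {k} (f : Fin k → A) → Injective _≡_ _≡_ f → Nodup (List.tabulate f)
  nodup-tabulate {zero}  f inj = tt
  nodup-tabulate {suc k} f inj =
    (λ m → case ∈-tabulate⁻ m of λ { (i , p) → case inj p of λ () }) ,
    nodup-tabulate (f ∘ suc) (FinP.suc-injective ∘ inj)

nodup-map : {A B : Set} (f : A → B) (xs : List A) →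
            (∀ {x y} → x ∈ₗ xs → y ∈ₗ xs → f x ≡ f y → x ≡ y) → Nodup xs → Nodup (List.map f xs)
nodup-map f []       inj nd         = tt
nodup-map f (x ∷ xs) inj (x∉ , nd) =
  (λ m → case ∈-map⁻ f m of λ { (y , y∈ , eq) → x∉ (subst (_∈ₗ xs) (sym (inj (here refl) (there y∈) eq)) y∈) }) ,
  nodup-map f xs (λ x∈ y∈ → inj (there x∈) (there y∈)) nd

setOf : ∀ {k} → List (Fin k) → Subset k
setOf []       = ∅
setOf (x ∷ xs) = ⁅ x ⁆ ∪ setOf xs

∈-setOf⁻ : ∀ {k} {v : Fin k} xs → v ∈ setOf xs → v ∈ₗ xs
∈-setOf⁻ []       v∈ = ⊥-elim (SetP.∉⊥ v∈)
∈-setOf⁻ (x ∷ xs) v∈ = [ here ∘ SetP.x∈⁅y⁆⇒x≡y x , there ∘ ∈-setOf⁻ xs ] (SetP.x∈p∪q⁻ ⁅ x ⁆ (setOf xs) v∈)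

∈-setOf⁺ : ∀ {k} {v : Fin k} {xs} → v ∈ₗ xs → v ∈ setOf xs
∈-setOf⁺ {xs = x ∷ xs} (here refl) = SetP.x∈p∪q⁺ (inj₁ (SetP.x∈⁅x⁆ x))
∈-setOf⁺ {xs = x ∷ xs} (there v∈)  = SetP.x∈p∪q⁺ (inj₂ (∈-setOf⁺ v∈))

elements : ∀ {k} → Subset k → List (Fin k)
elements []            = []
elements (inside ∷ p)  = zero ∷ List.map suc (elements p)
elements (outside ∷ p) = List.map suc (elements p)

∈-elements⁻ : ∀ {k} (p : Subset k) {x} → x ∈ₗ elements p → x ∈ p
∈-elements⁻ (inside ∷ p) (here refl) = vhere
∈-elements⁻ (inside ∷ p) (there x∈) with ∈-map⁻ suc x∈
... | _ , y∈ , refl = vthere (∈-elements⁻ p y∈)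
∈-elements⁻ (outside ∷ p) x∈ with ∈-map⁻ suc x∈
... | _ , y∈ , refl = vthere (∈-elements⁻ p y∈)

∈-elements⁺ : ∀ {k} (p : Subset k) {x} → x ∈ p → x ∈ₗ elements p
∈-elements⁺ (inside ∷ p)  vhere       = here refl
∈-elements⁺ (inside ∷ p)  (vthere x∈) = there (∈-map⁺ suc (∈-elements⁺ p x∈))
∈-elements⁺ (outside ∷ p) (vthere x∈) = ∈-map⁺ suc (∈-elements⁺ p x∈)

nodup-elements : ∀ {k} (p : Subset k) → Nodup (elements p)
nodup-elements []            = tt
nodup-elements (inside ∷ p)  =
  (λ m → case ∈-map⁻ suc m of λ { (_ , _ , ()) }) , nodup-map suc (elements p) (λ _ _ → FinP.suc-injective) (nodup-elements p)
nodup-elements (outside ∷ p) = nodup-map suc (elements p) (λ _ _ → FinP.suc-injective) (nodup-elements p)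

𝟙 : {P : Set} → Dec P → ℕ
𝟙 (yes _) = 1
𝟙 (no _)  = 0

count : ∀ {k} → Subset k → List (Fin k) → ℕ
count P []       = 0
count P (x ∷ xs) = 𝟙 (x ∈? P) + count P xs

count-++ : ∀ {k} (P : Subset k) xs ys → count P (xs ++ ys) ≡ count P xs + count P ys
count-++ P []       ys = refl
count-++ P (x ∷ xs) ys = trans (cong (λ k → 𝟙 (x ∈? P) + k) (count-++ P xs ys)) (sym (ℕP.+-assoc (𝟙 (x ∈? P)) _ _))

count-full : ∀ {k} (xs : List (Fin k)) → count full xs ≡ length xs
count-full []       = refl
count-full (x ∷ xs) with x ∈? full
... | yes _ = cong suc (count-full xs)
... | no x∉ = ⊥-elim (x∉ SetP.∈⊤)

remove : ∀ {k} → Subset k → Fin k → Subset k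
remove (b ∷ p) zero    = outside ∷ p
remove (b ∷ p) (suc x) = b ∷ remove p x

∣remove∣ : ∀ {k} (p : Subset k) (x : Fin k) → x ∈ p → ∣ p ∣ ≡ suc ∣ remove p x ∣
∣remove∣ (inside ∷ p)  zero    vhere       = refl
∣remove∣ (inside ∷ p)  (suc x) (vthere x∈) = cong suc (∣remove∣ p x x∈)
∣remove∣ (outside ∷ p) (suc x) (vthere x∈) = ∣remove∣ p x x∈

∈-remove⁻ : ∀ {k} (p : Subset k) (x y : Fin k) → y ∈ remove p x → y ∈ p × y ≢ x
∈-remove⁻ (b ∷ p) zero    (suc y) (vthere y∈) = vthere y∈ , λ ()
∈-remove⁻ (b ∷ p) (suc x) zero    vhere       = vhere , λ ()
∈-remove⁻ (b ∷ p) (suc x) (suc y) (vthere y∈) with ∈-remove⁻ p x y y∈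
... | y∈p , y≢x = vthere y∈p , y≢x ∘ FinP.suc-injective

∈-remove⁺ : ∀ {k} (p : Subset k) (x y : Fin k) → y ∈ p → y ≢ x → y ∈ remove p x
∈-remove⁺ (b ∷ p) zero    zero    _           y≢x = ⊥-elim (y≢x refl)
∈-remove⁺ (b ∷ p) zero    (suc y) (vthere y∈) _   = vthere y∈
∈-remove⁺ (b ∷ p) (suc x) zero    vhere       _   = vhere
∈-remove⁺ (b ∷ p) (suc x) (suc y) (vthere y∈) y≢x = vthere (∈-remove⁺ p x y y∈ (y≢x ∘ cong suc))

∣empty∣ : ∀ {k} (p : Subset k) → (∀ x → x ∉ p) → ∣ p ∣ ≡ 0
∣empty∣ []            _     = refl
∣empty∣ (inside ∷ p)  empty = ⊥-elim (empty zero vhere)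
∣empty∣ (outside ∷ p) empty = ∣empty∣ p (λ x → empty (suc x) ∘ vthere)

subset-ext : ∀ {k} {S S′ : Subset k} → (∀ v → v ∈ S → v ∈ S′) → (∀ v → v ∈ S′ → v ∈ S) → S ≡ S′
subset-ext f g = SetP.⊆-antisym (f _) (g _)

Enumerates : ∀ {k} → List (Fin k) → Subset k → Set
Enumerates xs S = Nodup xs × (∀ v → v ∈ S → v ∈ₗ xs) × (∀ v → v ∈ₗ xs → v ∈ S)

∣∩∣≡count : ∀ {k} xs (S P : Subset k) → Enumerates xs S → ∣ S ∩ P ∣ ≡ count P xs
∣∩∣≡count []       S P (_ , sound , _) = ∣empty∣ (S ∩ P) (λ v v∈ → case sound v (proj₁ (SetP.x∈p∩q⁻ S P v∈)) of λ ())
∣∩∣≡count (x ∷ xs) S P ((x∉ , nd) , sound , complete) with x ∈? P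
... | yes x∈P = begin
  ∣ S ∩ P ∣                  ≡⟨ ∣remove∣ (S ∩ P) x (SetP.x∈p∩q⁺ (complete x (here refl) , x∈P)) ⟩
  suc ∣ remove (S ∩ P) x ∣   ≡⟨ cong (suc ∘ ∣_∣) remove-∩ ⟩
  suc ∣ remove S x ∩ P ∣     ≡⟨ cong suc (∣∩∣≡count xs (remove S x) P rest) ⟩
  suc (count P xs)           ∎
  where
  open ≡-Reasoning
  rest : Enumerates xs (remove S x)
  rest = nd , (λ v v∈ → case ∈-remove⁻ S x v v∈ of λ { (v∈S , v≢x) → case sound v v∈S of λ { (here p) → ⊥-elim (v≢x p) ; (there v∈xs) → v∈xs } })
            , (λ v v∈ → ∈-remove⁺ S x v (complete v (there v∈)) (λ { refl → x∉ v∈ }))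
  remove-∩ : remove (S ∩ P) x ≡ remove S x ∩ P
  remove-∩ = subset-ext
    (λ v v∈ → let (v∈S∩P , v≢x) = ∈-remove⁻ (S ∩ P) x v v∈ ; (v∈S , v∈P) = SetP.x∈p∩q⁻ S P v∈S∩P
              in SetP.x∈p∩q⁺ (∈-remove⁺ S x v v∈S v≢x , v∈P))
    (λ v v∈ → let (v∈S′ , v∈P) = SetP.x∈p∩q⁻ (remove S x) P v∈ ; (v∈S , v≢x) = ∈-remove⁻ S x v v∈S′
              in ∈-remove⁺ (S ∩ P) x v (SetP.x∈p∩q⁺ (v∈S , v∈P)) v≢x)
... | no x∉P = trans (cong ∣_∣ ∩-remove) (∣∩∣≡count xs (remove S x) P rest)
  where
  rest : Enumerates xs (remove S x)
  rest = nd , (λ v v∈ → case ∈-remove⁻ S x v v∈ of λ { (v∈S , v≢x) → case sound v v∈S of λ { (here p) → ⊥-elim (v≢x p) ; (there v∈xs) → v∈xs } })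
            , (λ v v∈ → ∈-remove⁺ S x v (complete v (there v∈)) (λ { refl → x∉ v∈ }))
  ∩-remove : S ∩ P ≡ remove S x ∩ P
  ∩-remove = subset-ext
    (λ v v∈ → let (v∈S , v∈P) = SetP.x∈p∩q⁻ S P v∈ in SetP.x∈p∩q⁺ (∈-remove⁺ S x v v∈S (λ { refl → x∉P v∈P }) , v∈P))
    (λ v v∈ → let (v∈S′ , v∈P) = SetP.x∈p∩q⁻ (remove S x) P v∈ in SetP.x∈p∩q⁺ (proj₁ (∈-remove⁻ S x v v∈S′) , v∈P))

∣∣≡length : ∀ {k} (S : Subset k) xs → Enumerates xs S → ∣ S ∣ ≡ length xs
∣∣≡length S xs enum = begin
  ∣ S ∣           ≡⟨ cong ∣_∣ (SetP.∩-identityʳ S) ⟨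
  ∣ S ∩ full ∣   ≡⟨ ∣∩∣≡count xs S full enum ⟩
  count full xs  ≡⟨ count-full xs ⟩
  length xs       ∎
  where open ≡-Reasoning

top-or-inject₁ : ∀ {L} (i : Fin (suc L)) → i ≡ fromℕ L ⊎ ∃[ k ] i ≡ inject₁ k
top-or-inject₁ {zero}  zero    = inj₁ refl
top-or-inject₁ {suc L} zero    = inj₂ (zero , refl)
top-or-inject₁ {suc L} (suc i) with top-or-inject₁ i
... | inj₁ eq       = inj₁ (cong suc eq)
... | inj₂ (k , eq) = inj₂ (suc k , cong suc eq)

module _ {A : Set} {L} (f : Fin (suc L) → A) (inj : Injective _≡_ _≡_ (f ∘ inject₁)) (closed : f zero ≡ f (fromℕ L)) where

  private
    top≢inner : ∀ {i j} (k : Fin L) → suc i ≡ fromℕ L → suc j ≡ inject₁ k → f (suc i) ≢ f (suc j)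
    top≢inner zero    _     ()  _
    top≢inner (suc k) i-top j≡k eq with inj (trans closed (trans (cong f (sym i-top)) (trans eq (cong f j≡k))))
    ... | ()

  closed-shift-injective : Injective _≡_ _≡_ (f ∘ suc)
  closed-shift-injective {i} {j} eq with top-or-inject₁ (suc i) | top-or-inject₁ (suc j)
  ... | inj₁ i-top     | inj₁ j-top       = FinP.suc-injective (trans i-top (sym j-top))
  ... | inj₂ (k , i≡k) | inj₂ (k′ , j≡k′) =
    FinP.suc-injective (trans i≡k (trans (cong inject₁ (inj (subst₂ (λ a b → f a ≡ f b) i≡k j≡k′ eq))) (sym j≡k′)))
  ... | inj₁ i-top     | inj₂ (k , j≡k)   = ⊥-elim (top≢inner k i-top j≡k eq)
  ... | inj₂ (k , i≡k) | inj₁ j-top       = ⊥-elim (top≢inner k j-top i≡k (sym eq))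

module Walks (G : Graph) where

  -- A walk is given by its start vertex together with the list of its steps (edge, vertex reached).
  Step : Set
  Step = Edg G × Vtx G

  verts : Vtx G → List Step → List (Vtx G)
  verts u []            = u ∷ []
  verts u ((e , v) ∷ w) = u ∷ verts v w

  targets : List Step → List (Vtx G)
  targets = List.map proj₂

  edges : List Step → List (Edg G)
  edges = List.map proj₁

  endpoint : Vtx G → List Step → Vtx G
  endpoint u []            = u
  endpoint u ((e , v) ∷ w) = endpoint v w

  firstEdge : List Step → Maybe (Edg G)
  firstEdge []            = nothing
  firstEdge ((e , v) ∷ w) = just e

  lastEdge : List Step → Maybe (Edg G)
  lastEdge []                = nothing
  lastEdge ((e , v) ∷ [])    = just e
  lastEdge (_ ∷ s ∷ w)       = lastEdge (s ∷ w)

  IsWalk : Vtx G → List Step → Set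
  IsWalk u []            = ⊤
  IsWalk u ((e , v) ∷ w) = Joins G e u v × IsWalk v w

  reverse : Vtx G → List Step → List Step
  reverse u []            = []
  reverse u ((e , v) ∷ w) = reverse v w ++ (e , u) ∷ []

  verts≡∷targets : ∀ u w → verts u w ≡ u ∷ targets w
  verts≡∷targets u []            = refl
  verts≡∷targets u ((e , v) ∷ w) = cong (u ∷_) (verts≡∷targets v w)

  endpoint-++ : ∀ u w w′ → endpoint u (w ++ w′) ≡ endpoint (endpoint u w) w′
  endpoint-++ u []            w′ = refl
  endpoint-++ u ((e , v) ∷ w) w′ = endpoint-++ v w w′

  endpoint-snoc : ∀ u w e v → endpoint u (w ++ (e , v) ∷ []) ≡ v
  endpoint-snoc u w e v = endpoint-++ u w _

  targets-++ : ∀ w w′ → targets (w ++ w′) ≡ targets w ++ targets w′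
  targets-++ = ListP.map-++ proj₂

  edges-++ : ∀ w w′ → edges (w ++ w′) ≡ edges w ++ edges w′
  edges-++ = ListP.map-++ proj₁

  verts-++ : ∀ u w w′ → verts u (w ++ w′) ≡ verts u w ++ targets w′
  verts-++ u []            w′ = verts≡∷targets u w′
  verts-++ u ((e , v) ∷ w) w′ = cong (u ∷_) (verts-++ v w w′)

  isWalk-++⁺ : ∀ u w w′ → IsWalk u w → IsWalk (endpoint u w) w′ → IsWalk u (w ++ w′)
  isWalk-++⁺ u []            w′ _        walk′ = walk′
  isWalk-++⁺ u ((e , v) ∷ w) w′ (j , walk) walk′ = j , isWalk-++⁺ v w w′ walk walk′

  isWalk-++⁻ : ∀ u w w′ → IsWalk u (w ++ w′) → IsWalk u w × IsWalk (endpoint u w) w′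
  isWalk-++⁻ u []            w′ walk     = tt , walk
  isWalk-++⁻ u ((e , v) ∷ w) w′ (j , walk) = let (walk₁ , walk₂) = isWalk-++⁻ v w w′ walk in (j , walk₁) , walk₂

  start∈verts : ∀ u w → u ∈ₗ verts u w
  start∈verts u []      = here refl
  start∈verts u (_ ∷ _) = here refl

  endpoint∈verts : ∀ u w → endpoint u w ∈ₗ verts u w
  endpoint∈verts u []            = here refl
  endpoint∈verts u ((e , v) ∷ w) = there (endpoint∈verts v w)

  endpoint∈targets : ∀ u w → w ≢ [] → endpoint u w ∈ₗ targets w
  endpoint∈targets u []            w≢[] = ⊥-elim (w≢[] refl)
  endpoint∈targets u ((e , v) ∷ w) _    = subst (endpoint v w ∈ₗ_) (verts≡∷targets v w) (endpoint∈verts v w)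

  targets⊆verts : ∀ u w {v} → v ∈ₗ targets w → v ∈ₗ verts u w
  targets⊆verts u w {v} v∈ = subst (v ∈ₗ_) (sym (verts≡∷targets u w)) (there v∈)

  ∈-targets⇒split : ∀ w {v} → v ∈ₗ targets w → ∃[ w₁ ] ∃[ e ] ∃[ w₂ ] (w ≡ w₁ ++ (e , v) ∷ w₂)
  ∈-targets⇒split ((e , v) ∷ w) (here refl) = [] , e , w , refl
  ∈-targets⇒split (s ∷ w)       (there v∈) with ∈-targets⇒split w v∈
  ... | w₁ , e , w₂ , eq = s ∷ w₁ , e , w₂ , cong (s ∷_) eq

  ∈-verts⇒split : ∀ u w {v} → v ∈ₗ verts u w → ∃[ w₁ ] ∃[ w₂ ] (w ≡ w₁ ++ w₂ × endpoint u w₁ ≡ v)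
  ∈-verts⇒split u w {v} v∈ with subst (v ∈ₗ_) (verts≡∷targets u w) v∈
  ... | here refl = [] , w , refl , refl
  ... | there v∈′ with ∈-targets⇒split w v∈′
  ... | w₁ , e , w₂ , eq =
    w₁ ++ (e , v) ∷ [] , w₂ , trans eq (sym (ListP.++-assoc w₁ _ w₂)) , endpoint-snoc u w₁ e v

  snoc-view : ∀ (s : Step) w → ∃[ w′ ] ∃[ e ] ∃[ v ] (s ∷ w ≡ w′ ++ (e , v) ∷ [])
  snoc-view (e , v) []      = [] , e , v , refl
  snoc-view s       (s′ ∷ w) with snoc-view s′ w
  ... | w′ , e , v , eq = s ∷ w′ , e , v , cong (s ∷_) eq

  snoc≢[] : ∀ w (s : Step) → w ++ s ∷ [] ≢ []
  snoc≢[] []      s ()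
  snoc≢[] (_ ∷ w) s ()

  lastEdge-snoc : ∀ w e v → lastEdge (w ++ (e , v) ∷ []) ≡ just e
  lastEdge-snoc []           e v = refl
  lastEdge-snoc (s ∷ [])     e v = refl
  lastEdge-snoc (s ∷ s′ ∷ w) e v = lastEdge-snoc (s′ ∷ w) e v

  lastEdge-++ : ∀ w s w′ → lastEdge (w ++ s ∷ w′) ≡ lastEdge (s ∷ w′)
  lastEdge-++ []           s w′ = refl
  lastEdge-++ (x ∷ [])     s w′ = refl
  lastEdge-++ (x ∷ y ∷ w)  s w′ = lastEdge-++ (y ∷ w) s w′

  snoc-++ : ∀ w (s : Step) w′ → (w ++ s ∷ []) ++ w′ ≡ w ++ s ∷ w′
  snoc-++ w s w′ = ListP.++-assoc w (s ∷ []) w′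

  joins-sym : ∀ {e u v} → Joins G e u v → Joins G e v u
  joins-sym (inj₁ eq) = inj₂ eq
  joins-sym (inj₂ eq) = inj₁ eq

  joins-unique : ∀ {e u v u′ v′} → Joins G e u v → Joins G e u′ v′ → (u ≡ u′ × v ≡ v′) ⊎ (u ≡ v′ × v ≡ u′)
  joins-unique (inj₁ refl) (inj₁ eq) = inj₁ (,-injectiveˡ eq , ,-injectiveʳ eq)
  joins-unique (inj₁ refl) (inj₂ eq) = inj₂ (,-injectiveˡ eq , ,-injectiveʳ eq)
  joins-unique (inj₂ refl) (inj₁ eq) = inj₂ (,-injectiveʳ eq , ,-injectiveˡ eq)
  joins-unique (inj₂ refl) (inj₂ eq) = inj₁ (,-injectiveʳ eq , ,-injectiveˡ eq)

  joins⇒incident : ∀ {e u v} → Joins G e u v → Incident G e u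
  joins⇒incident (inj₁ eq) = inj₁ (cong proj₁ eq)
  joins⇒incident (inj₂ eq) = inj₂ (cong proj₂ eq)

  ∈δ⇒incident : ∀ {e v} → e ∈ δ G v → Incident G e v
  ∈δ⇒incident {e} {v} e∈ = decode (trans (sym (VecP.lookup∘tabulate _ e)) (VecP.[]=⇒lookup e∈))
    where
    decode : (does (proj₁ (ends G e) ≟ v) ∨ does (proj₂ (ends G e) ≟ v)) ≡ true → Incident G e v
    decode _  with proj₁ (ends G e) ≟ v | proj₂ (ends G e) ≟ v
    decode _  | yes p | _     = inj₁ p
    decode _  | no _  | yes q = inj₂ q
    decode () | no _  | no _

  incident⇒∈δ : ∀ {e v} → Incident G e v → e ∈ δ G v
  incident⇒∈δ {e} {v} inc = VecP.lookup⇒[]= e _ (trans (VecP.lookup∘tabulate _ e) (encode inc))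
    where
    encode : Incident G e v → (does (proj₁ (ends G e) ≟ v) ∨ does (proj₂ (ends G e) ≟ v)) ≡ true
    encode inc with proj₁ (ends G e) ≟ v | proj₂ (ends G e) ≟ v
    ... | yes _ | _     = refl
    ... | no _  | yes _ = refl
    ... | no p  | no q  = ⊥-elim ([ p , q ] inc)

  ∈δ-joins : ∀ {e u v x} → Joins G e u v → e ∈ δ G x → u ≡ x ⊎ v ≡ x
  ∈δ-joins (inj₁ refl) e∈ = ∈δ⇒incident e∈
  ∈δ-joins (inj₂ refl) e∈ = swap (∈δ⇒incident e∈)

  joins⇒∈δˡ : ∀ {e u v} → Joins G e u v → e ∈ δ G u
  joins⇒∈δˡ = incident⇒∈δ ∘ joins⇒incident

  joins⇒∈δʳ : ∀ {e u v} → Joins G e u v → e ∈ δ G v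
  joins⇒∈δʳ = joins⇒∈δˡ ∘ joins-sym

  incident-edge-in-walk : ∀ u w {e x} → IsWalk u w → e ∈ₗ edges w → e ∈ δ G x → x ∈ₗ verts u w
  incident-edge-in-walk u ((e , v) ∷ w) (j , _) (here refl) e∈δ with ∈δ-joins j e∈δ
  ... | inj₁ refl = here refl
  ... | inj₂ refl = there (start∈verts v w)
  incident-edge-in-walk u ((e , v) ∷ w) (_ , walk) (there e∈) e∈δ = there (incident-edge-in-walk v w walk e∈ e∈δ)

  nodup-edges : ∀ u w → IsWalk u w → Nodup (verts u w) → Nodup (edges w)
  nodup-edges u []            _          _           = tt
  nodup-edges u ((e , v) ∷ w) (j , walk) (u∉ , nodup) =
    (λ e∈ → u∉ (incident-edge-in-walk v w walk e∈ (joins⇒∈δˡ j))) , nodup-edges v w walk nodup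

  endpoint-reverse : ∀ u w → endpoint (endpoint u w) (reverse u w) ≡ u
  endpoint-reverse u []            = refl
  endpoint-reverse u ((e , v) ∷ w) = begin
    endpoint (endpoint v w) (reverse v w ++ (e , u) ∷ [])           ≡⟨ endpoint-++ (endpoint v w) (reverse v w) _ ⟩
    endpoint (endpoint (endpoint v w) (reverse v w)) ((e , u) ∷ [])  ≡⟨ cong (λ x → endpoint x ((e , u) ∷ [])) (endpoint-reverse v w) ⟩
    u                                                               ∎
    where open ≡-Reasoning

  lastEdge-reverse : ∀ u w → lastEdge (reverse u w) ≡ firstEdge w
  lastEdge-reverse u []            = refl
  lastEdge-reverse u ((e , v) ∷ w) = lastEdge-snoc (reverse v w) e u

  firstEdge-snoc : ∀ w (s s′ : Step) → firstEdge ((w ++ s ∷ []) ++ s′ ∷ []) ≡ firstEdge (w ++ s ∷ [])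
  firstEdge-snoc []      s s′ = refl
  firstEdge-snoc (_ ∷ w) s s′ = refl

  firstEdge-reverse : ∀ u w → firstEdge (reverse u w) ≡ lastEdge w
  firstEdge-reverse u []                        = refl
  firstEdge-reverse u ((e , v) ∷ [])            = refl
  firstEdge-reverse u ((e , v) ∷ (e′ , v′) ∷ w) =
    trans (firstEdge-snoc (reverse v′ w) (e′ , v) (e , u)) (firstEdge-reverse v ((e′ , v′) ∷ w))

  reverse≢[] : ∀ u w → w ≢ [] → reverse u w ≢ []
  reverse≢[] u []            w≢[] = ⊥-elim (w≢[] refl)
  reverse≢[] u ((e , v) ∷ w) _    = snoc≢[] (reverse v w) (e , u)

  isWalk-reverse : ∀ u w → IsWalk u w → IsWalk (endpoint u w) (reverse u w)
  isWalk-reverse u []            _          = tt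
  isWalk-reverse u ((e , v) ∷ w) (j , walk) =
    isWalk-++⁺ (endpoint v w) (reverse v w) _ (isWalk-reverse v w walk)
      (subst (λ x → IsWalk x ((e , u) ∷ [])) (sym (endpoint-reverse v w)) (joins-sym j , tt))

  verts-reverse : ∀ u w → verts (endpoint u w) (reverse u w) ≡ List.reverse (verts u w)
  verts-reverse u []            = refl
  verts-reverse u ((e , v) ∷ w) = begin
    verts (endpoint v w) (reverse v w ++ (e , u) ∷ [])  ≡⟨ verts-++ (endpoint v w) (reverse v w) _ ⟩
    verts (endpoint v w) (reverse v w) ++ u ∷ []        ≡⟨ cong (_++ u ∷ []) (verts-reverse v w) ⟩
    List.reverse (verts v w) ++ u ∷ []                  ≡⟨ ListP.unfold-reverse u (verts v w) ⟨
    List.reverse (u ∷ verts v w)                        ∎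
    where open ≡-Reasoning

  UniqueInner : Vtx G → List Step → Set
  UniqueInner u w = ∀ w₁ e v w₂ → w ≡ w₁ ++ (e , v) ∷ w₂ → w₂ ≢ [] → v ∉ₗ verts u w₁ × v ∉ₗ targets w₂

  uniqueInner-path : ∀ u w → Nodup (verts u w) → UniqueInner u w
  uniqueInner-path u w nodup w₁ e v w₂ refl _
    with nodup-++⁻ (verts u w₁) (v ∷ targets w₂) (subst Nodup (verts-++ u w₁ ((e , v) ∷ w₂)) nodup)
  ... | _ , (v∉ , _) , disj = (λ v∈ → disj v∈ (here refl)) , v∉

  uniqueInner-closed : ∀ u w → Nodup (targets w) → endpoint u w ≡ u → UniqueInner u w
  uniqueInner-closed u w nodup closed w₁ e v w₂ refl w₂≢[]
    with nodup-++⁻ (targets w₁) (v ∷ targets w₂) (subst Nodup (targets-++ w₁ ((e , v) ∷ w₂)) nodup)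
  ... | _ , (v∉ , _) , disj = v∉verts , v∉
    where
    u∈w₂ : u ∈ₗ targets w₂
    u∈w₂ = subst (_∈ₗ targets w₂) (trans (sym (endpoint-++ u w₁ ((e , v) ∷ w₂))) closed) (endpoint∈targets v w₂ w₂≢[])
    v∉verts : v ∉ₗ verts u w₁
    v∉verts v∈ with subst (v ∈ₗ_) (verts≡∷targets u w₁) v∈
    ... | here refl  = v∉ u∈w₂
    ... | there v∈′ = disj v∈′ (here refl)

  inner-split : ∀ u w {v} → v ∈ₗ verts u w → v ≢ u → v ≢ endpoint u w →
                ∃[ w₁ ] ∃[ e ] ∃[ w₂ ] (w ≡ w₁ ++ (e , v) ∷ w₂ × w₂ ≢ [])
  inner-split u w {v} v∈ v≢u v≢end with subst (v ∈ₗ_) (verts≡∷targets u w) v∈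
  ... | here v≡u = ⊥-elim (v≢u v≡u)
  ... | there v∈′ with ∈-targets⇒split w v∈′
  ... | w₁ , e , [] , refl     = ⊥-elim (v≢end (sym (endpoint-snoc u w₁ e v)))
  ... | w₁ , e , s ∷ w₂ , eq   = w₁ , e , s ∷ w₂ , eq , λ ()

  split-∈verts : ∀ u w₁ e v w₂ → v ∈ₗ verts u (w₁ ++ (e , v) ∷ w₂)
  split-∈verts u w₁ e v w₂ = subst (v ∈ₗ_) (sym (verts-++ u w₁ ((e , v) ∷ w₂))) (∈-++⁺ʳ (verts u w₁) (here refl))

  suffix-nodup : ∀ u w₁ w₂ → Nodup (verts u (w₁ ++ w₂)) → Nodup (verts (endpoint u w₁) w₂)
  suffix-nodup u w₁ w₂ nodup with nodup-++⁻ (verts u w₁) (targets w₂) (subst Nodup (verts-++ u w₁ w₂) nodup)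
  ... | _ , nodup₂ , disj =
    subst Nodup (sym (verts≡∷targets (endpoint u w₁) w₂)) (disj (endpoint∈verts u w₁) , nodup₂)

  suffix-⊆verts : ∀ u w₁ w₂ {v} → v ∈ₗ verts (endpoint u w₁) w₂ → v ∈ₗ verts u (w₁ ++ w₂)
  suffix-⊆verts u w₁ w₂ {v} v∈ with subst (v ∈ₗ_) (verts≡∷targets (endpoint u w₁) w₂) v∈
  ... | here refl = subst (v ∈ₗ_) (sym (verts-++ u w₁ w₂)) (∈-++⁺ˡ (endpoint∈verts u w₁))
  ... | there v∈′ = subst (v ∈ₗ_) (sym (verts-++ u w₁ w₂)) (∈-++⁺ʳ (verts u w₁) v∈′)

  closed-verts⊆targets : ∀ u w {v} → w ≢ [] → endpoint u w ≡ u → v ∈ₗ verts u w → v ∈ₗ targets w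
  closed-verts⊆targets u w {v} w≢[] closed v∈ with subst (v ∈ₗ_) (verts≡∷targets u w) v∈
  ... | here refl = subst (_∈ₗ targets w) closed (endpoint∈targets u w w≢[])
  ... | there v∈′ = v∈′

  inner-≢ends : ∀ u w w₁ e v w₂ → UniqueInner u w → w ≡ w₁ ++ (e , v) ∷ w₂ → w₂ ≢ [] → v ≢ u × v ≢ endpoint u w
  inner-≢ends u w w₁ e v w₂ unique refl w₂≢[] with unique w₁ e v w₂ refl w₂≢[]
  ... | v∉₁ , v∉₂ = (λ { refl → v∉₁ (start∈verts u w₁) })
                  , (λ v≡end → v∉₂ (subst (_∈ₗ targets w₂) (trans (sym (endpoint-++ u w₁ ((e , v) ∷ w₂))) (sym v≡end))
                                       (endpoint∈targets v w₂ w₂≢[])))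

  record Traversal (P : Sub G) (s : Vtx G) : Set where
    field
      steps      : List Step
      isWalk     : IsWalk s steps
      verts⁺     : ∀ v → v ∈ V P → v ∈ₗ verts s steps
      verts⁻     : ∀ v → v ∈ₗ verts s steps → v ∈ V P
      edges-enum : Enumerates (edges steps) (E P)

  record PathTraversal (P : Sub G) (s t : Vtx G) : Set where
    field
      traversal : Traversal P s
    open Traversal traversal public
    field
      ends-at : endpoint s steps ≡ t
      nodup   : Nodup (verts s steps)

  record CircuitTraversal (P : Sub G) (s : Vtx G) : Set where
    field
      traversal : Traversal P s
    open Traversal traversal public
    field
      closed        : endpoint s steps ≡ s
      nodup-targets : Nodup (targets steps)
      nonempty      : steps ≢ []

  module _ {L : ℕ} (vs : Fin (suc L) → Vtx G) (es : Fin L → Edg G) where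

    stepsOf : List Step
    stepsOf = List.tabulate (λ i → es i , vs (suc i))

    targets-stepsOf : targets stepsOf ≡ List.tabulate (vs ∘ suc)
    targets-stepsOf = ListP.map-tabulate _ proj₂

    verts-stepsOf : verts (vs zero) stepsOf ≡ List.tabulate vs
    verts-stepsOf = trans (verts≡∷targets (vs zero) stepsOf) (cong (vs zero ∷_) targets-stepsOf)

    edges-stepsOf : edges stepsOf ≡ List.tabulate es
    edges-stepsOf = ListP.map-tabulate _ proj₁

  endpoint-stepsOf : ∀ {L} (vs : Fin (suc L) → Vtx G) es → endpoint (vs zero) (stepsOf vs es) ≡ vs (fromℕ L)
  endpoint-stepsOf {zero}  vs es = refl
  endpoint-stepsOf {suc L} vs es = endpoint-stepsOf (vs ∘ suc) (es ∘ suc)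

  isWalk-stepsOf : ∀ {L} (vs : Fin (suc L) → Vtx G) es → (∀ i → Joins G (es i) (vs (inject₁ i)) (vs (suc i))) →
                   IsWalk (vs zero) (stepsOf vs es)
  isWalk-stepsOf {zero}  vs es joins = tt
  isWalk-stepsOf {suc L} vs es joins = joins zero , isWalk-stepsOf (vs ∘ suc) (es ∘ suc) (joins ∘ suc)

  traversal-stepsOf : ∀ {P L} (vs : Fin (suc L) → Vtx G) es → (∀ i → Joins G (es i) (vs (inject₁ i)) (vs (suc i))) →
    (∀ v → v ∈ V P ⇔ (∃[ i ] vs i ≡ v)) → (∀ e → e ∈ E P ⇔ (∃[ i ] es i ≡ e)) → Nodup (List.tabulate es) →
    Traversal P (vs zero)
  traversal-stepsOf {P} vs es joins V-img E-img es-nodup = record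
    { steps      = stepsOf vs es
    ; isWalk     = isWalk-stepsOf vs es joins
    ; verts⁺     = λ v v∈ → case Equivalence.to (V-img v) v∈ of λ { (i , refl) →
                     subst (v ∈ₗ_) (sym (verts-stepsOf vs es)) (∈-tabulate⁺ {f = vs} i) }
    ; verts⁻     = λ v v∈ → Equivalence.from (V-img v) (from-tabulate {f = vs} (subst (v ∈ₗ_) (verts-stepsOf vs es) v∈))
    ; edges-enum = subst Nodup (sym (edges-stepsOf vs es)) es-nodup
                 , (λ e e∈ → case Equivalence.to (E-img e) e∈ of λ { (i , refl) →
                     subst (e ∈ₗ_) (sym (edges-stepsOf vs es)) (∈-tabulate⁺ {f = es} i) })
                 , (λ e e∈ → Equivalence.from (E-img e) (from-tabulate {f = es} (subst (e ∈ₗ_) (edges-stepsOf vs es) e∈)))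
    }
    where
    from-tabulate : ∀ {A : Set} {k} {f : Fin k → A} {x} → x ∈ₗ List.tabulate f → ∃[ i ] f i ≡ x
    from-tabulate x∈ = let (i , eq) = ∈-tabulate⁻ x∈ in i , sym eq

  path-traversal : ∀ {P s t} → IsPath G P s t → PathTraversal P s t
  path-traversal {P} {s} {t} p = subst (λ x → PathTraversal P x t) start record
    { traversal = traversal-stepsOf vs es joins V-img E-img
                    (subst Nodup (edges-stepsOf vs es) (nodup-edges (vs zero) (stepsOf vs es) (isWalk-stepsOf vs es joins) nodup-verts))
    ; ends-at   = trans (endpoint-stepsOf vs es) finish
    ; nodup     = nodup-verts
    }
    where
    open IsPath p
    nodup-verts : Nodup (verts (vs zero) (stepsOf vs es))
    nodup-verts = subst Nodup (sym (verts-stepsOf vs es)) (nodup-tabulate vs vs-inj)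

  circuit-traversal : ∀ {P} (c : IsCircuit G P) → CircuitTraversal P (IsCircuit.vs c zero)
  circuit-traversal {P} c = record
    { traversal     = traversal-stepsOf vs es joins V-img E-img (nodup-tabulate es es-inj)
    ; closed        = trans (endpoint-stepsOf vs es) (sym closed)
    ; nodup-targets = subst Nodup (sym (targets-stepsOf vs es)) (nodup-tabulate (vs ∘ suc) (closed-shift-injective vs vs-inj closed))
    ; nonempty      = tabulate≢[] len≥2
    }
    where
    open IsCircuit c
    tabulate≢[] : ∀ {L} {f : Fin L → Step} → 2 ≤ L → List.tabulate f ≢ []
    tabulate≢[] {suc L} _ ()

  rotate : ∀ {P c z} → CircuitTraversal P c → z ∈ V P → CircuitTraversal P z
  rotate {P} {c} {z} C z∈P with ∈-verts⇒split c steps (verts⁺ z z∈P)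
    where open CircuitTraversal C
  ... | w₁ , w₂ , refl , refl = record
    { traversal = record
      { steps      = w₂ ++ w₁
      ; isWalk     = isWalk-++⁺ z w₂ w₁ walk₂ (subst (λ x → IsWalk x w₁) (sym closes) walk₁)
      ; verts⁺     = λ v v∈ → targets⊆verts z (w₂ ++ w₁) (targets-comm w₁ w₂ (closed-verts⊆targets c (w₁ ++ w₂) nonempty closed (verts⁺ v v∈)))
      ; verts⁻     = λ v v∈ → verts⁻ v (targets⊆verts c (w₁ ++ w₂) (targets-comm w₂ w₁ (closed-verts⊆targets z (w₂ ++ w₁) nonempty′ closed′ v∈)))
      ; edges-enum = subst Nodup (sym (edges-++ w₂ w₁)) (nodup-++-comm (edges w₁) (edges w₂) (subst Nodup (edges-++ w₁ w₂) edges-nodup))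
                   , (λ e e∈ → edges-comm w₁ w₂ (edges-⊇ e e∈))
                   , (λ e e∈ → edges-⊆ e (edges-comm w₂ w₁ e∈))
      }
    ; closed        = closed′
    ; nodup-targets = subst Nodup (sym (targets-++ w₂ w₁)) (nodup-++-comm (targets w₁) (targets w₂) (subst Nodup (targets-++ w₁ w₂) nodup-targets))
    ; nonempty      = nonempty′
    }
    where
    open CircuitTraversal C
    edges-nodup : Nodup (edges (w₁ ++ w₂))
    edges-nodup = proj₁ edges-enum
    edges-⊇ : ∀ e → e ∈ E P → e ∈ₗ edges (w₁ ++ w₂)
    edges-⊇ = proj₁ (proj₂ edges-enum)
    edges-⊆ : ∀ e → e ∈ₗ edges (w₁ ++ w₂) → e ∈ E P
    edges-⊆ = proj₂ (proj₂ edges-enum)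
    walk₁ : IsWalk c w₁
    walk₁ = proj₁ (isWalk-++⁻ c w₁ w₂ isWalk)
    walk₂ : IsWalk z w₂
    walk₂ = proj₂ (isWalk-++⁻ c w₁ w₂ isWalk)
    closes : endpoint z w₂ ≡ c
    closes = trans (sym (endpoint-++ c w₁ w₂)) closed
    closed′ : endpoint z (w₂ ++ w₁) ≡ z
    closed′ = trans (endpoint-++ z w₂ w₁) (cong (λ x → endpoint x w₁) closes)
    nonempty′ : w₂ ++ w₁ ≢ []
    nonempty′ eq = nonempty (cong₂ _++_ (ListP.++-conicalʳ w₂ w₁ eq) (ListP.++-conicalˡ w₂ w₁ eq))
    targets-comm : ∀ {v} xs ys → v ∈ₗ targets (xs ++ ys) → v ∈ₗ targets (ys ++ xs)
    targets-comm {v} xs ys v∈ =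
      subst (v ∈ₗ_) (sym (targets-++ ys xs)) (∈-++-comm (targets xs) (targets ys) (subst (v ∈ₗ_) (targets-++ xs ys) v∈))
    edges-comm : ∀ {e} xs ys → e ∈ₗ edges (xs ++ ys) → e ∈ₗ edges (ys ++ xs)
    edges-comm {e} xs ys e∈ =
      subst (e ∈ₗ_) (sym (edges-++ ys xs)) (∈-++-comm (edges xs) (edges ys) (subst (e ∈ₗ_) (edges-++ xs ys) e∈))

  vertexAt : Vtx G → (w : List Step) → Fin (suc (length w)) → Vtx G
  vertexAt u w             zero    = u
  vertexAt u ((e , v) ∷ w) (suc i) = vertexAt v w i

  edgeAt : (w : List Step) → Fin (length w) → Edg G
  edgeAt ((e , v) ∷ w) zero    = e
  edgeAt ((e , v) ∷ w) (suc i) = edgeAt w i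

  vertexAt∈verts : ∀ u w i → vertexAt u w i ∈ₗ verts u w
  vertexAt∈verts u w             zero    = start∈verts u w
  vertexAt∈verts u ((e , v) ∷ w) (suc i) = there (vertexAt∈verts v w i)

  ∈verts⇒vertexAt : ∀ u w {x} → x ∈ₗ verts u w → ∃[ i ] vertexAt u w i ≡ x
  ∈verts⇒vertexAt u []            (here refl) = zero , refl
  ∈verts⇒vertexAt u ((e , v) ∷ w) (here refl) = zero , refl
  ∈verts⇒vertexAt u ((e , v) ∷ w) (there x∈) = let (i , eq) = ∈verts⇒vertexAt v w x∈ in suc i , eq

  edgeAt∈edges : ∀ w i → edgeAt w i ∈ₗ edges w
  edgeAt∈edges ((e , v) ∷ w) zero    = here refl
  edgeAt∈edges ((e , v) ∷ w) (suc i) = there (edgeAt∈edges w i)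

  ∈edges⇒edgeAt : ∀ w {f} → f ∈ₗ edges w → ∃[ i ] edgeAt w i ≡ f
  ∈edges⇒edgeAt ((e , v) ∷ w) (here refl) = zero , refl
  ∈edges⇒edgeAt ((e , v) ∷ w) (there f∈) = let (i , eq) = ∈edges⇒edgeAt w f∈ in suc i , eq

  vertexAt-injective : ∀ u w → Nodup (verts u w) → Injective _≡_ _≡_ (vertexAt u w)
  vertexAt-injective u w             _          {zero}  {zero}  _  = refl
  vertexAt-injective u ((e , v) ∷ w) (u∉ , _)   {zero}  {suc j} eq = ⊥-elim (u∉ (subst (_∈ₗ verts v w) (sym eq) (vertexAt∈verts v w j)))
  vertexAt-injective u ((e , v) ∷ w) (u∉ , _)   {suc i} {zero}  eq = ⊥-elim (u∉ (subst (_∈ₗ verts v w) eq (vertexAt∈verts v w i)))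
  vertexAt-injective u ((e , v) ∷ w) (_ , nodup) {suc i} {suc j} eq = cong suc (vertexAt-injective v w nodup eq)

  vertexAt-joins : ∀ u w → IsWalk u w → ∀ i → Joins G (edgeAt w i) (vertexAt u w (inject₁ i)) (vertexAt u w (suc i))
  vertexAt-joins u ((e , v) ∷ w) (j , _)    zero    = j
  vertexAt-joins u ((e , v) ∷ w) (_ , walk) (suc i) = vertexAt-joins v w walk i

  vertexAt-last : ∀ u w → vertexAt u w (fromℕ (length w)) ≡ endpoint u w
  vertexAt-last u []            = refl
  vertexAt-last u ((e , v) ∷ w) = vertexAt-last v w

  walkSub : Vtx G → List Step → Sub G
  walkSub u w = sub (setOf (verts u w)) (setOf (edges w))

  walkSub-isPath : ∀ u w → IsWalk u w → Nodup (verts u w) → IsPath G (walkSub u w) u (endpoint u w)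
  walkSub-isPath u w walk nodup = record
    { len    = length w
    ; vs     = vertexAt u w
    ; es     = edgeAt w
    ; vs-inj = vertexAt-injective u w nodup
    ; joins  = vertexAt-joins u w walk
    ; start  = refl
    ; finish = vertexAt-last u w
    ; V-img  = λ v → mk⇔ (∈verts⇒vertexAt u w ∘ ∈-setOf⁻ (verts u w)) (λ { (i , refl) → ∈-setOf⁺ (vertexAt∈verts u w i) })
    ; E-img  = λ e → mk⇔ (∈edges⇒edgeAt w ∘ ∈-setOf⁻ (edges w)) (λ { (i , refl) → ∈-setOf⁺ (edgeAt∈edges w i) })
    }

module FWalks (G : Graph) (F : Subset (m G)) where
  open Walks G

  inF : Edg G → ℕ
  inF e = 𝟙 (e ∈? F)

  inFᵐ : Maybe (Edg G) → ℕ
  inFᵐ nothing  = 0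
  inFᵐ (just e) = inF e

  inF-cases : ∀ e → (inF e ≡ 1 × e ∈ F) ⊎ (inF e ≡ 0 × e ∉ F)
  inF-cases e with e ∈? F
  ... | yes e∈F = inj₁ (refl , e∈F)
  ... | no e∉F  = inj₂ (refl , e∉F)

  inFᵐ-cases : ∀ me → inFᵐ me ≡ 1 ⊎ inFᵐ me ≡ 0
  inFᵐ-cases nothing  = inj₂ refl
  inFᵐ-cases (just e) = Sum.map proj₁ proj₁ (inF-cases e)

  fdeg : Vtx G → List Step → ℕ
  fdeg x w = count (δ G x ∩ F) (edges w)

  𝟙-∉ : ∀ {k} {x : Fin k} {P} → x ∉ P → 𝟙 (x ∈? P) ≡ 0
  𝟙-∉ {x = x} {P} x∉ with x ∈? P
  ... | yes x∈ = ⊥-elim (x∉ x∈)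
  ... | no _   = refl

  𝟙-∩ : ∀ {k} {x : Fin k} {S} P → x ∈ S → 𝟙 (x ∈? (S ∩ P)) ≡ 𝟙 (x ∈? P)
  𝟙-∩ {x = x} {S} P x∈S with x ∈? (S ∩ P) | x ∈? P
  ... | yes _    | yes _   = refl
  ... | no _     | no _    = refl
  ... | yes x∈SP | no x∉P  = ⊥-elim (x∉P (proj₂ (SetP.x∈p∩q⁻ S P x∈SP)))
  ... | no x∉SP  | yes x∈P = ⊥-elim (x∉SP (SetP.x∈p∩q⁺ (x∈S , x∈P)))

  fdeg-away : ∀ u w x → IsWalk u w → x ∉ₗ verts u w → fdeg x w ≡ 0
  fdeg-away u []            x _          _  = refl
  fdeg-away u ((e , v) ∷ w) x (j , walk) x∉ = cong₂ _+_ (𝟙-∉ e∉) (fdeg-away v w x walk (x∉ ∘ there))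
    where
    e∉ : e ∉ δ G x ∩ F
    e∉ e∈ = [ (λ { refl → x∉ (here refl) }) , (λ { refl → x∉ (there (start∈verts v w)) }) ]
              (∈δ-joins j (proj₁ (SetP.x∈p∩q⁻ (δ G x) F e∈)))

  fdeg-start : ∀ x w → IsWalk x w → x ∉ₗ targets w → fdeg x w ≡ inFᵐ (firstEdge w)
  fdeg-start x []            _          _  = refl
  fdeg-start x ((e , v) ∷ w) (j , walk) x∉ =
    trans (cong₂ _+_ (𝟙-∩ F (joins⇒∈δˡ j)) (fdeg-away v w x walk (x∉ ∘ subst (x ∈ₗ_) (verts≡∷targets v w))))
          (ℕP.+-identityʳ _)

  fdeg-inner : ∀ u w₁ e x w₂ → IsWalk u (w₁ ++ (e , x) ∷ w₂) → x ∉ₗ verts u w₁ → x ∉ₗ targets w₂ →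
               fdeg x (w₁ ++ (e , x) ∷ w₂) ≡ inF e + inFᵐ (firstEdge w₂)
  fdeg-inner u w₁ e x w₂ walk x∉₁ x∉₂ with isWalk-++⁻ u w₁ ((e , x) ∷ w₂) walk
  ... | walk₁ , (j , walk₂) = begin
    count (δ G x ∩ F) (edges (w₁ ++ (e , x) ∷ w₂))      ≡⟨ cong (count (δ G x ∩ F)) (edges-++ w₁ ((e , x) ∷ w₂)) ⟩
    count (δ G x ∩ F) (edges w₁ ++ e ∷ edges w₂)        ≡⟨ count-++ (δ G x ∩ F) (edges w₁) (e ∷ edges w₂) ⟩
    fdeg x w₁ + (𝟙 (e ∈? (δ G x ∩ F)) + fdeg x w₂)     ≡⟨ cong₂ _+_ (fdeg-away u w₁ x walk₁ x∉₁)
                                                           (cong₂ _+_ (𝟙-∩ F (joins⇒∈δʳ j)) (fdeg-start x w₂ walk₂ x∉₂)) ⟩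
    inF e + inFᵐ (firstEdge w₂)                         ∎
    where open ≡-Reasoning

  degF≡fdeg : ∀ (P : Sub G) w x → Enumerates (edges w) (E P) → degF G F P x ≡ fdeg x w
  degF≡fdeg P w x enum = trans (cong ∣_∣ reassoc) (∣∩∣≡count (edges w) (E P) (δ G x ∩ F) enum)
    where
    reassoc : δ G x ∩ E P ∩ F ≡ E P ∩ (δ G x ∩ F)
    reassoc = begin
      δ G x ∩ (E P ∩ F)   ≡⟨ SetP.∩-assoc (δ G x) (E P) F ⟨
      (δ G x ∩ E P) ∩ F   ≡⟨ cong (_∩ F) (SetP.∩-comm (δ G x) (E P)) ⟩
      (E P ∩ δ G x) ∩ F   ≡⟨ SetP.∩-assoc (E P) (δ G x) F ⟩
      E P ∩ (δ G x ∩ F)   ∎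
      where open ≡-Reasoning

  -- Balanced (_∈ B) is F-balancedness of a path; Balanced (λ _ → ⊤) says that every inner vertex
  -- meets exactly one F-edge of the walk.
  BalancedAt : (Vtx G → Set) → Vtx G → Maybe (Edg G) → Maybe (Edg G) → Set
  BalancedAt Checked x (just e) (just e′) = Checked x → inF e + inF e′ ≡ 1
  BalancedAt Checked x _        _         = ⊤

  Balanced : (Vtx G → Set) → Vtx G → List Step → Set
  Balanced Checked u []            = ⊤
  Balanced Checked u ((e , v) ∷ w) = BalancedAt Checked v (just e) (firstEdge w) × Balanced Checked v w

  module _ (Checked : Vtx G → Set) where

    balancedAt-sym : ∀ x me me′ → BalancedAt Checked x me me′ → BalancedAt Checked x me′ me
    balancedAt-sym x (just e) (just e′) bal c = trans (ℕP.+-comm (inF e′) (inF e)) (bal c)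
    balancedAt-sym x (just e) nothing   _     = tt
    balancedAt-sym x nothing  (just e′) _     = tt
    balancedAt-sym x nothing  nothing   _     = tt

    balancedAt-nothingʳ : ∀ x me → BalancedAt Checked x me nothing
    balancedAt-nothingʳ x (just e) = tt
    balancedAt-nothingʳ x nothing  = tt

    balanced-++⁺ : ∀ u w w′ → Balanced Checked u w → Balanced Checked (endpoint u w) w′ →
                   BalancedAt Checked (endpoint u w) (lastEdge w) (firstEdge w′) → Balanced Checked u (w ++ w′)
    balanced-++⁺ u []                       w′ _           bal′ _    = bal′
    balanced-++⁺ u ((e , v) ∷ [])           w′ _           bal′ join = join , bal′
    balanced-++⁺ u ((e , v) ∷ (e′ , v′) ∷ w) w′ (at , bal) bal′ join = at , balanced-++⁺ v ((e′ , v′) ∷ w) w′ bal bal′ join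

    balanced-++⁻ : ∀ u w w′ → Balanced Checked u (w ++ w′) →
                   Balanced Checked u w × Balanced Checked (endpoint u w) w′ × BalancedAt Checked (endpoint u w) (lastEdge w) (firstEdge w′)
    balanced-++⁻ u []                        w′ bal        = tt , bal , tt
    balanced-++⁻ u ((e , v) ∷ [])            w′ (at , bal) = (tt , tt) , bal , at
    balanced-++⁻ u ((e , v) ∷ (e′ , v′) ∷ w) w′ (at , bal) with balanced-++⁻ v ((e′ , v′) ∷ w) w′ bal
    ... | bal₁ , bal₂ , join = (at , bal₁) , bal₂ , join

    balanced-reverse : ∀ u w → Balanced Checked u w → Balanced Checked (endpoint u w) (reverse u w)
    balanced-reverse u []            _          = tt
    balanced-reverse u ((e , v) ∷ w) (at , bal) =
      balanced-++⁺ (endpoint v w) (reverse v w) ((e , u) ∷ []) (balanced-reverse v w bal) (tt , tt)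
        (subst₂ (λ x me → BalancedAt Checked x me (just e)) (sym (endpoint-reverse v w)) (sym (lastEdge-reverse v w))
          (balancedAt-sym v (just e) (firstEdge w) at))

    balanced-splits : ∀ u w → (∀ w₁ w₂ → w ≡ w₁ ++ w₂ → BalancedAt Checked (endpoint u w₁) (lastEdge w₁) (firstEdge w₂)) →
                      Balanced Checked u w
    balanced-splits u []            _     = tt
    balanced-splits u ((e , v) ∷ w) split = split ((e , v) ∷ []) w refl , balanced-splits v w split′
      where
      split′ : ∀ w₁ w₂ → w ≡ w₁ ++ w₂ → BalancedAt Checked (endpoint v w₁) (lastEdge w₁) (firstEdge w₂)
      split′ []       w₂ _  = tt
      split′ (s ∷ w₁) w₂ eq = split ((e , v) ∷ s ∷ w₁) w₂ (cong ((e , v) ∷_) eq)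

    InnerDegreeOne : Sub G → Vtx G → List Step → Set
    InnerDegreeOne P u w = ∀ w₁ e x w₂ → w ≡ w₁ ++ (e , x) ∷ w₂ → w₂ ≢ [] → Checked x → degF G F P x ≡ 1

    degF-inner : ∀ (P : Sub G) u w → IsWalk u w → Enumerates (edges w) (E P) → UniqueInner u w →
                 ∀ w₁ e x e′ x′ w₂ → w ≡ w₁ ++ (e , x) ∷ (e′ , x′) ∷ w₂ → degF G F P x ≡ inF e + inF e′
    degF-inner P u w walk enum unique w₁ e x e′ x′ w₂ refl =
      let (x∉₁ , x∉₂) = unique w₁ e x ((e′ , x′) ∷ w₂) refl (λ ())
      in trans (degF≡fdeg P w x enum) (fdeg-inner u w₁ e x ((e′ , x′) ∷ w₂) walk x∉₁ x∉₂)

    balanced-fromDegF : ∀ (P : Sub G) u w → IsWalk u w → Enumerates (edges w) (E P) → UniqueInner u w →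
                        InnerDegreeOne P u w → Balanced Checked u w
    balanced-fromDegF P u w walk enum unique deg1 = balanced-splits u w at-split
      where
      at-split : ∀ w₁ w₂ → w ≡ w₁ ++ w₂ → BalancedAt Checked (endpoint u w₁) (lastEdge w₁) (firstEdge w₂)
      at-split []       w₂                eq = tt
      at-split (s ∷ w₁) []                eq = balancedAt-nothingʳ _ _
      at-split (s ∷ w₁) ((e′ , x′) ∷ w₂) eq with snoc-view s w₁
      ... | w₀ , e , x , eq₁ =
        subst₂ (λ y me → BalancedAt Checked y me (just e′))
          (trans (sym (endpoint-snoc u w₀ e x)) (cong (endpoint u) (sym eq₁)))
          (trans (sym (lastEdge-snoc w₀ e x)) (cong lastEdge (sym eq₁)))
          (λ c → trans (sym (degF-inner P u w walk enum unique w₀ e x e′ x′ w₂ split)) (deg1 w₀ e x ((e′ , x′) ∷ w₂) split (λ ()) c))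
        where
        split : w ≡ w₀ ++ (e , x) ∷ (e′ , x′) ∷ w₂
        split = trans eq (trans (cong (_++ (e′ , x′) ∷ w₂) eq₁) (snoc-++ w₀ (e , x) ((e′ , x′) ∷ w₂)))

    degF-fromBalanced : ∀ (P : Sub G) u w → IsWalk u w → Enumerates (edges w) (E P) → UniqueInner u w →
                        Balanced Checked u w → InnerDegreeOne P u w
    degF-fromBalanced P u w walk enum unique bal w₁ e x []                split w₂≢[] = ⊥-elim (w₂≢[] refl)
    degF-fromBalanced P u w walk enum unique bal w₁ e x ((e′ , x′) ∷ w₂) split _ c
      with balanced-++⁻ u (w₁ ++ (e , x) ∷ []) ((e′ , x′) ∷ w₂) (subst (Balanced Checked u) (trans split (sym (snoc-++ w₁ _ _))) bal)
    ... | _ , _ , join rewrite endpoint-snoc u w₁ e x | lastEdge-snoc w₁ e x =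
      trans (degF-inner P u w walk enum unique w₁ e x e′ x′ w₂ split) (join c)

  balanced-mono : ∀ {Checked Checked′ : Vtx G → Set} → (∀ {x} → Checked′ x → Checked x) →
                  ∀ u w → Balanced Checked u w → Balanced Checked′ u w
  balanced-mono f u []                        _          = tt
  balanced-mono f u ((e , v) ∷ [])            _          = tt , tt
  balanced-mono f u ((e , v) ∷ (e′ , v′) ∷ w) (at , bal) = at ∘ f , balanced-mono f v ((e′ , v′) ∷ w) bal

  walkSub-enum : ∀ u w → Nodup (edges w) → Enumerates (edges w) (E (walkSub u w))
  walkSub-enum u w nodup = nodup , (λ e → ∈-setOf⁻ (edges w)) , (λ e → ∈-setOf⁺)

  walkSub-balancedPath : ∀ {B} u w → IsWalk u w → Nodup (verts u w) → Balanced (_∈ B) u w →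
                         BalancedPath G B F (walkSub u w) u (endpoint u w)
  walkSub-balancedPath {B} u w walk nodup bal = walkSub-isPath u w walk nodup , degree-one
    where
    degree-one : ∀ v → v ∈ V (walkSub u w) → v ∈ B → v ≢ u → v ≢ endpoint u w → degF G F (walkSub u w) v ≡ 1
    degree-one v v∈ v∈B v≢u v≢end with inner-split u w (∈-setOf⁻ (verts u w) v∈) v≢u v≢end
    ... | w₁ , e , w₂ , split , w₂≢[] =
      degF-fromBalanced (_∈ B) (walkSub u w) u w walk (walkSub-enum u w (nodup-edges u w walk nodup))
        (uniqueInner-path u w nodup) bal w₁ e v w₂ split w₂≢[] v∈B

+[m+n]-+n≡+m : ∀ k b → (+ (k + b)) ℤ.- (+ b) ≡ + k
+[m+n]-+n≡+m k b = begin
  + (k + b) ℤ.- + b   ≡⟨ ℤP.m-n≡m⊖n (k + b) b ⟩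
  (k + b) ⊖ b         ≡⟨ ℤP.≤-⊖ (ℕP.m≤n+m b k) ⟩
  + (k + b ∸ b)       ≡⟨ cong +_ (ℕP.m+n∸n≡m k b) ⟩
  + k                 ∎
  where open ≡-Reasoning

module BalancedWeight (G : Graph) (F : Subset (m G)) (B : Subset (n G))
  (alternates : ∀ {e u v} → Joins G e u v → (u ∈ B → v ∉ B) × (u ∉ B → v ∈ B)) where
  open Walks G
  open FWalks G F

  numF numNonF : List Step → ℕ
  numF    w = count F (edges w)
  numNonF w = count (∁ F) (edges w)

  wF≡numNonF-numF : ∀ (P : Sub G) w → Enumerates (edges w) (E P) → wF G F P ≡ + numNonF w ℤ.- + numF w
  wF≡numNonF-numF P w enum =
    cong₂ (λ a b → + a ℤ.- + b) (∣∩∣≡count (edges w) (E P) (∁ F) enum) (∣∩∣≡count (edges w) (E P) F enum)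

  edge-split : ∀ e → (inF e ≡ 1 × 𝟙 (e ∈? ∁ F) ≡ 0) ⊎ (inF e ≡ 0 × 𝟙 (e ∈? ∁ F) ≡ 1)
  edge-split e with e ∈? F | e ∈? ∁ F
  ... | yes e∈F | yes e∈∁F = ⊥-elim (SetP.x∈∁p⇒x∉p e∈∁F e∈F)
  ... | yes _   | no _     = inj₁ (refl , refl)
  ... | no _    | yes _    = inj₂ (refl , refl)
  ... | no e∉F  | no e∉∁F  = ⊥-elim (e∉∁F (SetP.x∉p⇒x∈∁p e∉F))

  record Surplus (u : Vtx G) (w : List Step) : Set where
    field
      from-A      : u ∉ B → numNonF w ≡ 1 + numF w
      from-B-F    : u ∈ B → inFᵐ (firstEdge w) ≡ 1 → numNonF w ≡ numF w
      from-B-nonF : u ∈ B → inFᵐ (firstEdge w) ≡ 0 → numNonF w ≡ 2 + numF w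

  surplus : ∀ u e v w → IsWalk u ((e , v) ∷ w) → Balanced (_∈ B) u ((e , v) ∷ w) → endpoint v w ∈ B →
            inFᵐ (lastEdge ((e , v) ∷ w)) ≡ 0 → Surplus u ((e , v) ∷ w)
  surplus u e v [] (j , _) _ v∈B last∉F with edge-split e
  ... | inj₁ (e∈F , _)     = case trans (sym e∈F) last∉F of λ ()
  ... | inj₂ (e∉F , e∈∁F) = record
    { from-A      = λ _ → trans (cong₂ _+_ e∈∁F refl) (cong (λ k → suc (k + 0)) (sym e∉F))
    ; from-B-F    = λ u∈B → ⊥-elim (proj₁ (alternates j) u∈B v∈B)
    ; from-B-nonF = λ u∈B → ⊥-elim (proj₁ (alternates j) u∈B v∈B)
    }
  surplus u e v ((e′ , v′) ∷ w) (j , walk) (at , bal) end∈B last∉F =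
    record { from-A = from-A ; from-B-F = from-B-F ; from-B-nonF = from-B-nonF }
    where
    rest = (e′ , v′) ∷ w
    open Surplus (surplus v e′ v′ w walk bal end∈B last∉F) renaming (from-A to ih-A; from-B-F to ih-B-F; from-B-nonF to ih-B-nonF)
    from-A : u ∉ B → numNonF ((e , v) ∷ rest) ≡ 1 + numF ((e , v) ∷ rest)
    from-A u∉B with proj₂ (alternates j) u∉B | edge-split e | edge-split e′
    ... | v∈B | inj₁ (e∈F , _)    | inj₁ (e′∈F , _) = case trans (sym (at v∈B)) (cong₂ _+_ e∈F e′∈F) of λ ()
    ... | v∈B | inj₂ (e∉F , _)    | inj₂ (e′∉F , _) = case trans (sym (at v∈B)) (cong₂ _+_ e∉F e′∉F) of λ ()
    ... | v∈B | inj₁ (e∈F , e∉∁F) | inj₂ (e′∉F , _) =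
      trans (cong₂ _+_ e∉∁F (ih-B-nonF v∈B e′∉F)) (cong (λ k → suc (k + numF rest)) (sym e∈F))
    ... | v∈B | inj₂ (e∉F , e∈∁F) | inj₁ (e′∈F , _) =
      trans (cong₂ _+_ e∈∁F (ih-B-F v∈B e′∈F)) (cong (λ k → suc (k + numF rest)) (sym e∉F))
    from-B-F : u ∈ B → inF e ≡ 1 → numNonF ((e , v) ∷ rest) ≡ numF ((e , v) ∷ rest)
    from-B-F u∈B e∈F with edge-split e
    ... | inj₁ (_ , e∉∁F) = trans (cong₂ _+_ e∉∁F (ih-A (proj₁ (alternates j) u∈B))) (cong (_+ numF rest) (sym e∈F))
    ... | inj₂ (e∉F , _)  = case trans (sym e∈F) e∉F of λ ()
    from-B-nonF : u ∈ B → inF e ≡ 0 → numNonF ((e , v) ∷ rest) ≡ 2 + numF ((e , v) ∷ rest)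
    from-B-nonF u∈B e∉F with edge-split e
    ... | inj₂ (_ , e∈∁F) = trans (cong₂ _+_ e∈∁F (ih-A (proj₁ (alternates j) u∈B))) (cong (λ k → 2 + (k + numF rest)) (sym e∉F))
    ... | inj₁ (e∈F , _)  = case trans (sym e∈F) e∉F of λ ()

  module _ (P : Sub G) (u : Vtx G) (e : Edg G) (v : Vtx G) (w : List Step) (enum : Enumerates (edges ((e , v) ∷ w)) (E P))
           (walk : IsWalk u ((e , v) ∷ w)) (bal : Balanced (_∈ B) u ((e , v) ∷ w)) (end∈B : endpoint v w ∈ B)
           (last∉F : inFᵐ (lastEdge ((e , v) ∷ w)) ≡ 0) where

    private
      open Surplus (surplus u e v w walk bal end∈B last∉F)

      wF≡ : ∀ k → numNonF ((e , v) ∷ w) ≡ k + numF ((e , v) ∷ w) → wF G F P ≡ + k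
      wF≡ k eq = trans (wF≡numNonF-numF P ((e , v) ∷ w) enum) (trans (cong (λ a → + a ℤ.- + numF ((e , v) ∷ w)) eq) (+[m+n]-+n≡+m k (numF ((e , v) ∷ w))))

    wF∈01 : (u ∈ B → inF e ≡ 1) → wF G F P ≡ + 0 ⊎ wF G F P ≡ + 1
    wF∈01 first∈F with u ∈? B
    ... | yes u∈B = inj₁ (wF≡ 0 (from-B-F u∈B (first∈F u∈B)))
    ... | no u∉B  = inj₂ (wF≡ 1 (from-A u∉B))

    first∈F-from-wF : u ∈ B → wF G F P ≡ + 0 ⊎ wF G F P ≡ + 1 → inF e ≡ 1
    first∈F-from-wF u∈B wF∈01 with inF-cases e
    ... | inj₁ (e∈F , _)  = e∈F
    ... | inj₂ (e∉F , _) = ⊥-elim ([ (λ eq → case trans (sym wF≡2) eq of λ ()) , (λ eq → case trans (sym wF≡2) eq of λ ()) ] wF∈01)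
      where
      wF≡2 : wF G F P ≡ + 2
      wF≡2 = wF≡ 2 (from-B-nonF u∈B e∉F)

  PerfectlyMatchedAt : Vtx G → Maybe (Edg G) → Set
  PerfectlyMatchedAt v me = (v ∈ B → inFᵐ me ≡ 1) × (v ∉ B → inFᵐ me ≡ 0)

  perfectlyMatched-propagates : ∀ u w → IsWalk u w → Balanced (λ _ → ⊤) u w → PerfectlyMatchedAt u (firstEdge w) →
                                ∀ w₁ w₂ → w ≡ w₁ ++ w₂ → w₂ ≢ [] → PerfectlyMatchedAt (endpoint u w₁) (firstEdge w₂)
  perfectlyMatched-propagates u w walk bal matched [] w₂ refl _ = matched
  perfectlyMatched-propagates u ((e , v) ∷ .(w₁ ++ w₂)) (j , walk) (at , bal) matched ((e , v) ∷ w₁) w₂ refl w₂≢[] =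
    perfectlyMatched-propagates v (w₁ ++ w₂) walk bal (next (firstEdge (w₁ ++ w₂)) (firstEdge-++ w₁ w₂ w₂≢[]) at) w₁ w₂ refl w₂≢[]
    where
    firstEdge-++ : ∀ w₁ w₂ → w₂ ≢ [] → firstEdge (w₁ ++ w₂) ≢ nothing
    firstEdge-++ []      []      w₂≢[] _ = w₂≢[] refl
    firstEdge-++ []      (_ ∷ _) _     ()
    firstEdge-++ (_ ∷ _) _       _     ()
    next : ∀ me → me ≢ nothing → BalancedAt (λ _ → ⊤) v (just e) me → PerfectlyMatchedAt v me
    next nothing   me≢nothing _  = ⊥-elim (me≢nothing refl)
    next (just e′) _          at′ with u ∈? B
    ... | yes u∈B = (λ v∈B → ⊥-elim (proj₁ (alternates j) u∈B v∈B))
                  , (λ _ → ℕP.+-cancelˡ-≡ 1 (inF e′) 0 (trans (cong (_+ inF e′) (sym (proj₁ matched u∈B))) (at′ tt)))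
    ... | no u∉B  = (λ _ → trans (sym (cong (_+ inF e′) (proj₂ matched u∉B))) (at′ tt))
                  , (λ v∉B → ⊥-elim (v∉B (proj₂ (alternates j) u∉B)))

module Bipartition (G : Graph) {A B : Subset (n G)} (bip : IsBipartition G A B) where
  open Walks G

  A∩B-empty : ∀ {v} → v ∈ A → v ∈ B → ⊥
  A∩B-empty {v} v∈A v∈B with proj₁ bip v
  ... | inj₁ (_ , v∉B) = v∉B v∈B
  ... | inj₂ (_ , v∉A) = v∉A v∈A

  Coloured : Vtx G → Vtx G → Set
  Coloured x y = (x ∈ A × y ∈ B) ⊎ (x ∈ B × y ∈ A)

  joins-coloured : ∀ {e u v} → Joins G e u v → Coloured u v
  joins-coloured {e} (inj₁ eq) = subst (λ p → Coloured (proj₁ p) (proj₂ p)) eq (proj₂ bip e)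
  joins-coloured {e} (inj₂ eq) =
    swap (Sum.map Product.swap Product.swap (subst (λ p → Coloured (proj₁ p) (proj₂ p)) eq (proj₂ bip e)))

  alternates : ∀ {e u v} → Joins G e u v → (u ∈ B → v ∉ B) × (u ∉ B → v ∈ B)
  alternates j with joins-coloured j
  ... | inj₁ (u∈A , v∈B) = (λ u∈B → ⊥-elim (A∩B-empty u∈A u∈B)) , (λ _ → v∈B)
  ... | inj₂ (u∈B , v∈A) = (λ _ v∈B → A∩B-empty v∈A v∈B) , (λ u∉B → ⊥-elim (u∉B u∈B))

  B-end-unique : ∀ {e b b′} → b ∈ B → b′ ∈ B → e ∈ δ G b → e ∈ δ G b′ → b ≡ b′
  B-end-unique {e} b∈B b′∈B e∈δb e∈δb′ with proj₂ bip e | ∈δ⇒incident e∈δb | ∈δ⇒incident e∈δb′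
  ... | inj₁ (x∈A , _) | inj₁ refl | _         = ⊥-elim (A∩B-empty x∈A b∈B)
  ... | inj₁ (x∈A , _) | inj₂ _    | inj₁ refl = ⊥-elim (A∩B-empty x∈A b′∈B)
  ... | inj₁ _         | inj₂ p    | inj₂ q    = trans (sym p) q
  ... | inj₂ (_ , y∈A) | inj₂ refl | _         = ⊥-elim (A∩B-empty y∈A b∈B)
  ... | inj₂ (_ , y∈A) | inj₁ _    | inj₂ refl = ⊥-elim (A∩B-empty y∈A b′∈B)
  ... | inj₂ _         | inj₁ p    | inj₁ q    = trans (sym p) q

  module _ {T : Subset (n G)} {F : Subset (m G)} (join : IsJoin G T F) (B⊆T : B ⊆ T) (F≤B : ∣ F ∣ ≤ ∣ B ∣) where

    F-edge-at-B : ∀ b → b ∈ B → Nonempty (δ G b ∩ F)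
    F-edge-at-B b b∈B with SetP.nonempty? (δ G b ∩ F)
    ... | yes ne = ne
    ... | no ¬ne = ⊥-elim (Equivalence.from (join b) (B⊆T b∈B)
                     (subst (2 ∣_) (sym (∣empty∣ _ (λ x x∈ → ¬ne (x , x∈)))) (2 ∣0)))

    -- One chosen F-edge per vertex of B gives |B| distinct F-edges (an edge has only one end in B),
    -- so a second F-edge at z would make |F| > |B|.
    F-edge-unique : ∀ {z e₁ e₂} → z ∈ B → e₁ ∈ δ G z ∩ F → e₂ ∈ δ G z ∩ F → e₁ ≡ e₂
    F-edge-unique {z} {e₁} {e₂} z∈B e₁∈ e₂∈ with e₁ ≟ e₂
    ... | yes e₁≡e₂ = e₁≡e₂
    ... | no e₁≢e₂  = ⊥-elim (ℕP.n≮n ∣ B ∣ (begin-strict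
      ∣ B ∣                  ≡⟨ ∣∣≡length B (elements B) (nodup-elements B , (λ _ → ∈-elements⁺ B) , (λ _ → ∈-elements⁻ B)) ⟩
      length (elements B)    ≡⟨ ListP.length-map pick (elements B) ⟨
      length picked          <⟨ ℕP.n<1+n _ ⟩
      length (e₂ ∷ picked)   ≡⟨ ∣∣≡length (setOf (e₂ ∷ picked)) (e₂ ∷ picked) (nodup-all , (λ _ → ∈-setOf⁻ _) , (λ _ → ∈-setOf⁺)) ⟨
      ∣ setOf (e₂ ∷ picked) ∣ ≤⟨ SetP.p⊆q⇒∣p∣≤∣q∣ all⊆F ⟩
      ∣ F ∣                  ≤⟨ F≤B ⟩
      ∣ B ∣                  ∎))
      where
      open ℕP.≤-Reasoning
      pick : Vtx G → Edg G
      pick b with b ≟ z | SetP.nonempty? (δ G b ∩ F)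
      ... | yes _ | _            = e₁
      ... | no _  | yes (e , _)  = e
      ... | no _  | no _         = e₁
      pick-∈ : ∀ b → b ∈ B → pick b ∈ δ G b ∩ F
      pick-∈ b b∈B with b ≟ z | SetP.nonempty? (δ G b ∩ F)
      ... | yes refl | _            = e₁∈
      ... | no _     | yes (_ , e∈) = e∈
      ... | no _     | no ¬ne       = ⊥-elim (¬ne (F-edge-at-B b b∈B))
      pick-z : pick z ≡ e₁
      pick-z with z ≟ z
      ... | yes _   = refl
      ... | no z≢z  = ⊥-elim (z≢z refl)
      δ-pick : ∀ {b} → b ∈ₗ elements B → pick b ∈ δ G b
      δ-pick {b} b∈ = proj₁ (SetP.x∈p∩q⁻ _ _ (pick-∈ b (∈-elements⁻ B b∈)))
      pick-injective : ∀ {x y} → x ∈ₗ elements B → y ∈ₗ elements B → pick x ≡ pick y → x ≡ y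
      pick-injective {x} {y} x∈ y∈ eq =
        B-end-unique (∈-elements⁻ B x∈) (∈-elements⁻ B y∈) (δ-pick x∈) (subst (_∈ δ G y) (sym eq) (δ-pick y∈))
      picked : List (Edg G)
      picked = List.map pick (elements B)
      e₂∉picked : e₂ ∉ₗ picked
      e₂∉picked e₂∈picked with ∈-map⁻ pick e₂∈picked
      ... | b , b∈ , e₂≡pick = e₁≢e₂ (trans (sym pick-z) (trans (cong pick z≡b) (sym e₂≡pick)))
        where
        z≡b : z ≡ b
        z≡b = B-end-unique z∈B (∈-elements⁻ B b∈) (proj₁ (SetP.x∈p∩q⁻ _ _ e₂∈)) (subst (_∈ δ G b) (sym e₂≡pick) (δ-pick b∈))
      nodup-all : Nodup (e₂ ∷ picked)
      nodup-all = e₂∉picked , nodup-map pick (elements B) pick-injective (nodup-elements B)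
      all⊆F : setOf (e₂ ∷ picked) ⊆ F
      all⊆F e∈ with ∈-setOf⁻ (e₂ ∷ picked) e∈
      ... | here refl = proj₂ (SetP.x∈p∩q⁻ _ _ e₂∈)
      ... | there e∈′ with ∈-map⁻ pick e∈′
      ... | b , b∈ , e≡pick = subst (_∈ F) (sym e≡pick) (proj₂ (SetP.x∈p∩q⁻ _ _ (pick-∈ b (∈-elements⁻ B b∈))))

module FactorComponents (G : Graph) {T : Subset (n G)} {F : Subset (m G)} (mj : MinJoin G T F)
  {V₀ : Subset (n G)} (fc : IsFactorComponent G T V₀) where
  open Walks G
  open FWalks G F

  F-edge-stays-in-V₀ : ∀ {e y x} → Joins G e y x → e ∈ F → y ∈ V₀ → x ∈ V₀
  F-edge-stays-in-V₀ {e} {y} {x} j e∈F y∈V₀ with y ≟ x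
  ... | yes refl = y∈V₀
  ... | no y≢x   = proj₂ (proj₂ fc) y x y∈V₀
    ( walkSub y ((e , x) ∷ [])
    , walkSub-isPath y ((e , x) ∷ []) (j , tt) ((λ { (here y≡x) → y≢x y≡x }) , (λ ()) , tt)
    , λ e′ e′∈ → case ∈-setOf⁻ (e ∷ []) e′∈ of λ { (here refl) → F , mj , e∈F })

  lastEdge∉F : ∀ z s w → IsWalk z (s ∷ w) → Nodup (verts z (s ∷ w)) → endpoint z (s ∷ w) ∈ V₀ →
               (∀ v → v ∈ₗ verts z (s ∷ w) → v ≢ endpoint z (s ∷ w) → v ∉ V₀) → inFᵐ (lastEdge (s ∷ w)) ≡ 0
  lastEdge∉F z s w walk nodup end∈V₀ avoid with snoc-view s w
  ... | w₀ , e , y , eq with inF-cases e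
  ... | inj₂ (e∉F , _) = trans (cong inFᵐ (trans (cong lastEdge eq) (lastEdge-snoc w₀ e y))) e∉F
  ... | inj₁ (_ , e∈F) = ⊥-elim (avoid p p∈ p≢end (F-edge-stays-in-V₀ (joins-sym j) e∈F y∈V₀))
    where
    p : Vtx G
    p = endpoint z w₀
    verts≡ : verts z (s ∷ w) ≡ verts z w₀ ++ y ∷ []
    verts≡ = trans (cong (verts z) eq) (verts-++ z w₀ _)
    end≡y : endpoint z (s ∷ w) ≡ y
    end≡y = trans (cong (endpoint z) eq) (endpoint-snoc z w₀ e y)
    y∈V₀ : y ∈ V₀
    y∈V₀ = subst (_∈ V₀) end≡y end∈V₀
    j : Joins G e p y
    j = proj₁ (proj₂ (isWalk-++⁻ z w₀ ((e , y) ∷ []) (subst (IsWalk z) eq walk)))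
    p∈ : p ∈ₗ verts z (s ∷ w)
    p∈ = subst (p ∈ₗ_) (sym verts≡) (∈-++⁺ˡ (endpoint∈verts z w₀))
    p≢end : p ≢ endpoint z (s ∷ w)
    p≢end p≡end = proj₂ (proj₂ (nodup-++⁻ (verts z w₀) (y ∷ []) (subst Nodup verts≡ nodup)))
                    (endpoint∈verts z w₀) (here (trans p≡end end≡y))

module GuideExtension (G : Graph) {T A B : Subset (n G)} (comb : IsComb G T A B) {F : Subset (m G)} (mj : MinJoin G T F)
  {V₀ : Subset (n G)} (fc : IsFactorComponent G T V₀) {X : Subset (n G)} {P : Sub G} (gd : Guide G B F V₀ X P) where
  open Walks G
  open FWalks G F
  open Bipartition G (proj₁ comb)
  open BalancedWeight G F B alternates
  open FactorComponents G mj fc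

  X∩V₀-empty : ∀ x → x ∈ X → x ∉ V₀
  X∩V₀-empty = proj₁ gd

  bond∈B : ∀ {y} → y ∈ bonds G V₀ P → y ∈ B
  bond∈B y∈ = proj₁ (SetP.x∈p∩q⁻ B V₀ (proj₁ (proj₂ (proj₂ gd)) y∈))

  bond∈V₀ : ∀ {y} → y ∈ bonds G V₀ P → y ∈ V₀
  bond∈V₀ y∈ = proj₂ (SetP.x∈p∩q⁻ (V P) V₀ y∈)

  ∣F∣≤∣B∣ : ∣ F ∣ ≤ ∣ B ∣
  ∣F∣≤∣B∣ with proj₂ (proj₂ (proj₂ comb))
  ... | (F′ , join′ , ∣F′∣≡∣B∣) , _ = subst (∣ F ∣ ≤_) ∣F′∣≡∣B∣ (proj₂ mj F′ join′)

  GuidePath : Subset (n G) → Vtx G → Set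
  GuidePath Y x = Σ (Sub G) λ R → Σ (Vtx G) λ y → y ∈ bonds G V₀ P × BalancedPath G B F R x y ×
                  (∀ v → v ∈ V R → v ≢ y → v ∈ Y) × (wF G F R ≡ + 0 ⊎ wF G F R ≡ + 1)

  guidePath : ∀ x → x ∈ X → GuidePath X x
  guidePath = proj₂ (proj₂ (proj₂ (proj₂ (proj₂ gd))))

  guidePath-mono : ∀ {Y Y′ x} → Y ⊆ Y′ → GuidePath Y x → GuidePath Y′ x
  guidePath-mono Y⊆Y′ (R , y , y-bond , bal , within , weight) =
    R , y , y-bond , bal , (λ v v∈ v≢y → Y⊆Y′ (within v v∈ v≢y)) , weight

  record GuideWalk (z : Vtx G) : Set where
    field
      y        : Vtx G
      y-bond   : y ∈ bonds G V₀ P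
      first    : Step
      rest     : List Step
      isWalk   : IsWalk z (first ∷ rest)
      ends-at  : endpoint z (first ∷ rest) ≡ y
      nodup    : Nodup (verts z (first ∷ rest))
      balanced : Balanced (_∈ B) z (first ∷ rest)
      within   : ∀ v → v ∈ₗ verts z (first ∷ rest) → v ≡ y ⊎ v ∈ X
      last∉F   : inFᵐ (lastEdge (first ∷ rest)) ≡ 0
      first∈F  : z ∈ B → inF (proj₁ first) ≡ 1

  guideWalk : ∀ z → z ∈ X → GuideWalk z
  guideWalk z z∈X with guidePath z z∈X
  ... | Rz , y , y-bond , (path , bal) , within , weight = walkOf (path-traversal path)
    where
    walkOf : PathTraversal Rz z y → GuideWalk z
    walkOf record { traversal = record { steps = [] } ; ends-at = z≡y } =
      ⊥-elim (X∩V₀-empty z z∈X (subst (_∈ V₀) (sym z≡y) (bond∈V₀ y-bond)))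
    walkOf record { traversal = record { steps = (e₁ , v₁) ∷ w ; isWalk = walk ; verts⁻ = verts⁻ ; edges-enum = enum }
                  ; ends-at = ends-at ; nodup = nodup } = record
      { y        = y
      ; y-bond   = y-bond
      ; first    = e₁ , v₁
      ; rest     = w
      ; isWalk   = walk
      ; ends-at  = ends-at
      ; nodup    = nodup
      ; balanced = balanced
      ; within   = within′
      ; last∉F   = last∉F
      ; first∈F  = λ z∈B → first∈F-from-wF Rz z e₁ v₁ w enum walk balanced
                             (subst (_∈ B) (sym ends-at) (bond∈B y-bond)) last∉F z∈B weight
      }
      where
      unique : UniqueInner z ((e₁ , v₁) ∷ w)
      unique = uniqueInner-path z ((e₁ , v₁) ∷ w) nodup
      balanced : Balanced (_∈ B) z ((e₁ , v₁) ∷ w)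
      balanced = balanced-fromDegF (_∈ B) Rz z _ walk enum unique λ w₁ e v w₂ split w₂≢[] v∈B →
        let (v≢z , v≢end) = inner-≢ends z _ w₁ e v w₂ unique split w₂≢[]
        in bal v (verts⁻ v (subst (v ∈ₗ_) (cong (verts z) (sym split)) (split-∈verts z w₁ e v w₂))) v∈B v≢z
               (λ v≡y → v≢end (trans v≡y (sym ends-at)))
      within′ : ∀ v → v ∈ₗ verts z ((e₁ , v₁) ∷ w) → v ≡ y ⊎ v ∈ X
      within′ v v∈ with v ≟ y
      ... | yes v≡y = inj₁ v≡y
      ... | no v≢y  = inj₂ (within v (verts⁻ v v∈) v≢y)
      last∉F : inFᵐ (lastEdge ((e₁ , v₁) ∷ w)) ≡ 0
      last∉F = lastEdge∉F z (e₁ , v₁) w walk nodup (subst (_∈ V₀) (sym ends-at) (bond∈V₀ y-bond)) λ v v∈ v≢end →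
        [ (λ v≡y → ⊥-elim (v≢end (trans v≡y (sym ends-at)))) , X∩V₀-empty v ] (within′ v v∈)

  junction-balanced : ∀ {x z} s S → IsWalk x (s ∷ S) → Nodup (verts x (s ∷ S)) → endpoint x (s ∷ S) ≡ z →
    ∀ e₁ v₁ → Joins G e₁ z v₁ → v₁ ∉ₗ verts x (s ∷ S) → (z ∈ B → inF e₁ ≡ 1) →
    BalancedAt (_∈ B) z (lastEdge (s ∷ S)) (just e₁)
  junction-balanced {x} {z} s S walk nodup ends e₁ v₁ j₁ v₁∉ first∈F with snoc-view s S
  ... | S′ , e , z′ , eq =
    subst (λ me → BalancedAt (_∈ B) z me (just e₁)) (sym (trans (cong lastEdge eq) (lastEdge-snoc S′ e z′))) at
    where
    p : Vtx G
    p = endpoint x S′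
    verts≡ : verts x (s ∷ S) ≡ verts x S′ ++ z′ ∷ []
    verts≡ = trans (cong (verts x) eq) (verts-++ x S′ _)
    z′≡z : z′ ≡ z
    z′≡z = trans (sym (endpoint-snoc x S′ e z′)) (trans (cong (endpoint x) (sym eq)) ends)
    j : Joins G e p z
    j = subst (Joins G e p) z′≡z (proj₁ (proj₂ (isWalk-++⁻ x S′ _ (subst (IsWalk x) eq walk))))
    p∈ : p ∈ₗ verts x (s ∷ S)
    p∈ = subst (p ∈ₗ_) (sym verts≡) (∈-++⁺ˡ (endpoint∈verts x S′))
    p≢z : p ≢ z
    p≢z p≡z = proj₂ (proj₂ (nodup-++⁻ (verts x S′) (z′ ∷ []) (subst Nodup verts≡ nodup)))
                (endpoint∈verts x S′) (here (trans p≡z (sym z′≡z)))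
    at : BalancedAt (_∈ B) z (just e) (just e₁)
    at z∈B with inF-cases e | inF-cases e₁
    ... | inj₂ (e∉F , _) | _              = trans (cong (_+ inF e₁) e∉F) (first∈F z∈B)
    ... | inj₁ _         | inj₂ (e₁∉F , _) = case trans (sym (first∈F z∈B)) e₁∉F of λ ()
    ... | inj₁ (_ , e∈F) | inj₁ (_ , e₁∈F)
      with F-edge-unique (proj₁ mj) (proj₁ (proj₂ (proj₂ comb))) ∣F∣≤∣B∣ z∈B
             (SetP.x∈p∩q⁺ (joins⇒∈δʳ j , e∈F)) (SetP.x∈p∩q⁺ (joins⇒∈δˡ j₁ , e₁∈F))
    ... | refl with joins-unique j j₁
    ... | inj₁ (p≡z , _)  = ⊥-elim (p≢z p≡z)
    ... | inj₂ (p≡v₁ , _) = ⊥-elim (v₁∉ (subst (_∈ₗ verts x (s ∷ S)) p≡v₁ p∈))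

  record Approach (Y : Subset (n G)) (x : Vtx G) : Set where
    field
      z         : Vtx G
      z∈X       : z ∈ X
      steps     : List Step
      nonempty  : steps ≢ []
      isWalk    : IsWalk x steps
      ends-at   : endpoint x steps ≡ z
      nodup     : Nodup (verts x steps)
      balanced  : Balanced (_∈ B) x steps
      first∈F   : x ∈ B → inFᵐ (firstEdge steps) ≡ 1
      meets-X   : ∀ v → v ∈ₗ verts x steps → v ∈ X → v ≡ z
      avoids-V₀ : ∀ v → v ∈ₗ verts x steps → v ∉ V₀
      within    : ∀ v → v ∈ₗ verts x steps → v ∈ Y

  extend : ∀ {Y x} → Approach Y x → GuidePath (X ∪ Y) x
  extend record { steps = [] ; nonempty = nonempty } = ⊥-elim (nonempty refl)
  extend {Y} {x} record { z = z ; z∈X = z∈X ; steps = (e₀ , v₀) ∷ S₀ ; isWalk = walk ; ends-at = ends ; nodup = nodup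
                        ; balanced = bal ; first∈F = first∈F ; meets-X = meets-X ; avoids-V₀ = avoids-V₀ ; within = within } =
    walkSub x R , y , y-bond , subst (BalancedPath G B F (walkSub x R) x) endsR (walkSub-balancedPath x R walkR nodupR balR) ,
    withinR , wF∈01 (walkSub x R) x e₀ v₀ (S₀ ++ W) (walkSub-enum x R (nodup-edges x R walkR nodupR)) walkR balR
                (subst (_∈ B) (sym endsR) (bond∈B y-bond)) (trans (cong inFᵐ (lastEdge-++ S first rest)) last∉F) first∈F
    where
    open GuideWalk (guideWalk z z∈X) renaming (isWalk to walk₂; ends-at to ends₂; nodup to nodup₂; balanced to bal₂; within to within₂; first∈F to first∈F₂)
    S W R : List Step
    S = (e₀ , v₀) ∷ S₀
    W = first ∷ rest
    R = S ++ W
    nodup-targets₂ : Nodup (targets W)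
    nodup-targets₂ = subst Nodup (verts≡∷targets (proj₂ first) rest) (proj₂ nodup₂)
    disjoint : ∀ {v} → v ∈ₗ verts x S → v ∉ₗ targets W
    disjoint {v} v∈S v∈W with within₂ v (targets⊆verts z W v∈W)
    ... | inj₁ v≡y = avoids-V₀ v v∈S (subst (_∈ V₀) (sym v≡y) (bond∈V₀ y-bond))
    ... | inj₂ v∈X with meets-X v v∈S v∈X
    ... | refl = proj₁ nodup₂ (subst (v ∈ₗ_) (sym (verts≡∷targets (proj₂ first) rest)) v∈W)
    walkR : IsWalk x R
    walkR = isWalk-++⁺ x S W walk (subst (λ q → IsWalk q W) (sym ends) walk₂)
    endsR : endpoint x R ≡ y
    endsR = trans (endpoint-++ x S W) (trans (cong (λ q → endpoint q W) ends) ends₂)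
    nodupR : Nodup (verts x R)
    nodupR = subst Nodup (sym (verts-++ x S W)) (nodup-++⁺ (verts x S) (targets W) nodup nodup-targets₂ disjoint)
    junction : BalancedAt (_∈ B) z (lastEdge S) (firstEdge W)
    junction = junction-balanced (e₀ , v₀) S₀ walk nodup ends (proj₁ first) (proj₂ first) (proj₁ walk₂)
                 (λ v₁∈ → disjoint v₁∈ (here refl)) first∈F₂
    balR : Balanced (_∈ B) x R
    balR = balanced-++⁺ (_∈ B) x S W bal (subst (λ q → Balanced (_∈ B) q W) (sym ends) bal₂)
             (subst (λ q → BalancedAt (_∈ B) q (lastEdge S) (firstEdge W)) (sym ends) junction)
    withinR : ∀ v → v ∈ V (walkSub x R) → v ≢ y → v ∈ X ∪ Y
    withinR v v∈ v≢y with ∈-++⁻ (verts x S) (subst (v ∈ₗ_) (verts-++ x S W) (∈-setOf⁻ (verts x R) v∈))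
    ... | inj₁ v∈S = SetP.x∈p∪q⁺ (inj₂ (within v v∈S))
    ... | inj₂ v∈W with within₂ v (targets⊆verts z W v∈W)
    ... | inj₁ v≡y = ⊥-elim (v≢y v≡y)
    ... | inj₂ v∈X = SetP.x∈p∪q⁺ (inj₁ v∈X)

  approach-along : ∀ {Q : Sub G} {x z} → z ∈ X → (∀ v → v ∈ V Q → v ∈ X → v ≡ z) → (∀ v → v ∈ V Q → v ∉ V₀) →
    ∀ w → w ≢ [] → IsWalk x w → endpoint x w ≡ z → Nodup (verts x w) → Balanced (_∈ B) x w →
    (x ∈ B → inFᵐ (firstEdge w) ≡ 1) → (∀ v → v ∈ₗ verts x w → v ∈ V Q) → Approach (V Q) x
  approach-along {Q} {x} {z} z∈X Q∩X⊆z Q∩V₀-empty w w≢[] walk ends nodup bal first∈F verts⊆Q = record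
    { z         = z
    ; z∈X       = z∈X
    ; steps     = w
    ; nonempty  = w≢[]
    ; isWalk    = walk
    ; ends-at   = ends
    ; nodup     = nodup
    ; balanced  = bal
    ; first∈F   = first∈F
    ; meets-X   = λ v v∈ → Q∩X⊆z v (verts⊆Q v v∈)
    ; avoids-V₀ = λ v v∈ → Q∩V₀-empty v (verts⊆Q v v∈)
    ; within    = verts⊆Q
    }

  Removed : Vtx G → Vtx G → Vtx G → Set
  Removed s t r = (r ≡ s × s ∈ A) ⊎ (r ≡ t × t ∈ B)

  module Straight {Q : Sub G} {s t} (path : IsPath G Q s t) (has-edge : Nonempty (E Q)) (t∈X : t ∈ X)
    (Q∩X⊆t : ∀ v → v ∈ V Q → v ∈ X → v ≡ t) (Q∩V₀-empty : ∀ v → v ∈ V Q → v ∉ V₀)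
    (F-avoids-removed : ∀ e → e ∈ E Q → e ∈ F → ¬ Removed s t (proj₁ (ends G e)) × ¬ Removed s t (proj₂ (ends G e)))
    (matched : ∀ v → v ∈ V Q → ¬ Removed s t v → degF G F Q v ≡ 1) where

    open PathTraversal (path-traversal path)

    nonempty : steps ≢ []
    nonempty steps≡[] = case subst (λ w → proj₁ has-edge ∈ₗ edges w) steps≡[] (proj₁ (proj₂ edges-enum) _ (proj₂ has-edge)) of λ ()

    s∉targets : s ∉ₗ targets steps
    s∉targets = proj₁ (subst Nodup (verts≡∷targets s steps) nodup)

    s≢t : s ≢ t
    s≢t s≡t = s∉targets (subst (_∈ₗ targets steps) (trans ends-at (sym s≡t)) (endpoint∈targets s steps nonempty))

    unique : UniqueInner s steps
    unique = uniqueInner-path s steps nodup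

    balanced : Balanced (λ _ → ⊤) s steps
    balanced = balanced-fromDegF (λ _ → ⊤) Q s steps isWalk edges-enum unique λ w₁ e v w₂ split w₂≢[] _ →
      let (v≢s , v≢end) = inner-≢ends s steps w₁ e v w₂ unique split w₂≢[]
      in matched v (verts⁻ v (subst (v ∈ₗ_) (cong (verts s) (sym split)) (split-∈verts s w₁ e v w₂)))
           [ (λ { (v≡s , _) → v≢s v≡s }) , (λ { (v≡t , _) → v≢end (trans v≡t (sym ends-at)) }) ]

    matched-at-s : PerfectlyMatchedAt s (firstEdge steps)
    matched-at-s = from-B , from-A
      where
      from-B : s ∈ B → inFᵐ (firstEdge steps) ≡ 1
      from-B s∈B = trans (sym (trans (degF≡fdeg Q steps s edges-enum) (fdeg-start s steps isWalk s∉targets)))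
                     (matched s (verts⁻ s (start∈verts s steps))
                       [ (λ { (_ , s∈A) → A∩B-empty s∈A s∈B }) , (λ { (s≡t , _) → s≢t s≡t }) ])
      from-A : s ∉ B → inFᵐ (firstEdge steps) ≡ 0
      from-A s∉B with steps | isWalk | nonempty | edges-enum
      ... | [] | _ | steps≢[] | _ = ⊥-elim (steps≢[] refl)
      ... | (e₁ , v₁) ∷ w | (j , _) | _ | (_ , _ , edges⊆) with inF-cases e₁ | proj₁ (proj₁ comb) s
      ... | inj₂ (e₁∉F , _) | _               = e₁∉F
      ... | inj₁ _          | inj₂ (s∈B , _)  = ⊥-elim (s∉B s∈B)
      ... | inj₁ (_ , e₁∈F) | inj₁ (s∈A , _)  with F-avoids-removed e₁ (edges⊆ e₁ (here refl)) e₁∈F | joins⇒incident j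
      ... | s-kept , _ | inj₁ end₁≡s = ⊥-elim (s-kept (inj₁ (end₁≡s , s∈A)))
      ... | _ , s-kept | inj₂ end₂≡s = ⊥-elim (s-kept (inj₁ (end₂≡s , s∈A)))

    approach : ∀ x → x ∈ V Q → x ∉ X → Approach (V Q) x
    approach x x∈Q x∉X with ∈-verts⇒split s steps (verts⁺ x x∈Q)
    ... | w₁ , w₂ , split , refl =
      approach-along {Q} t∈X Q∩X⊆t Q∩V₀-empty w₂ w₂≢[] (proj₂ (isWalk-++⁻ s w₁ w₂ walk′)) ends₂
        (suffix-nodup s w₁ w₂ (subst (Nodup ∘ verts s) split nodup))
        (balanced-mono (λ _ → tt) x w₂ (proj₁ (proj₂ (balanced-++⁻ (λ _ → ⊤) s w₁ w₂ (subst (Balanced (λ _ → ⊤) s) split balanced)))))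
        (proj₁ (perfectlyMatched-propagates s steps isWalk balanced matched-at-s w₁ w₂ split w₂≢[]))
        (λ v v∈ → verts⁻ v (subst (v ∈ₗ_) (cong (verts s) (sym split)) (suffix-⊆verts s w₁ w₂ v∈)))
      where
      walk′ : IsWalk s (w₁ ++ w₂)
      walk′ = subst (IsWalk s) split isWalk
      ends₂ : endpoint x w₂ ≡ t
      ends₂ = trans (sym (endpoint-++ s w₁ w₂)) (trans (cong (endpoint s) (sym split)) ends-at)
      w₂≢[] : w₂ ≢ []
      w₂≢[] refl = x∉X (subst (_∈ X) (sym ends₂) t∈X)

  module Round {Q : Sub G} (circuit : IsCircuit G Q) {z} (z∈Q : z ∈ V Q) (X⇔z : ∀ v → v ∈ V Q → (v ∈ X ⇔ v ≡ z))
    (bal : ∀ v → v ∈ int G X Q → v ∈ B → degF G F Q v ≡ 1) (Q∩V₀-empty : ∀ v → v ∈ V Q → v ∉ V₀) where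

    open CircuitTraversal (rotate (circuit-traversal circuit) z∈Q)

    z∈X : z ∈ X
    z∈X = Equivalence.from (X⇔z z z∈Q) refl

    Q∩X⊆z : ∀ v → v ∈ V Q → v ∈ X → v ≡ z
    Q∩X⊆z v v∈Q = Equivalence.to (X⇔z v v∈Q)

    unique : UniqueInner z steps
    unique = uniqueInner-closed z steps nodup-targets closed

    balanced : Balanced (_∈ B) z steps
    balanced = balanced-fromDegF (_∈ B) Q z steps isWalk edges-enum unique λ w₁ e v w₂ split w₂≢[] v∈B →
      let v∈Q = verts⁻ v (subst (v ∈ₗ_) (cong (verts z) (sym split)) (split-∈verts z w₁ e v w₂))
          v≢z = proj₁ (inner-≢ends z steps w₁ e v w₂ unique split w₂≢[])
      in bal v (SetP.x∈p∩q⁺ (v∈Q , SetP.x∉p⇒x∈∁p (v≢z ∘ Q∩X⊆z v v∈Q))) v∈B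

    module Leaving {x} (x∈Q : x ∈ V Q) (x∉X : x ∉ X) {w₁ e w₂} (split : steps ≡ w₁ ++ (e , x) ∷ w₂) where

      w₁′ : List Step
      w₁′ = w₁ ++ (e , x) ∷ []
      split′ : steps ≡ w₁′ ++ w₂
      split′ = trans split (sym (snoc-++ w₁ (e , x) w₂))
      walks : IsWalk z w₁′ × IsWalk (endpoint z w₁′) w₂
      walks = isWalk-++⁻ z w₁′ w₂ (subst (IsWalk z) split′ isWalk)

      bals : Balanced (_∈ B) z w₁′ × Balanced (_∈ B) (endpoint z w₁′) w₂ × _
      bals = balanced-++⁻ (_∈ B) z w₁′ w₂ (subst (Balanced (_∈ B) z) split′ balanced)

      disjoint : Nodup (targets w₁′) × Nodup (targets w₂) × (∀ {v} → v ∈ₗ targets w₁′ → v ∉ₗ targets w₂)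
      disjoint = nodup-++⁻ (targets w₁′) (targets w₂) (subst Nodup (trans (cong targets split′) (targets-++ w₁′ w₂)) nodup-targets)

      ends₂ : endpoint x w₂ ≡ z
      ends₂ = trans (cong (λ q → endpoint q w₂) (sym (endpoint-snoc z w₁ e x)))
                (trans (sym (endpoint-++ z w₁′ w₂)) (trans (cong (endpoint z) (sym split′)) closed))

      w₂≢[] : w₂ ≢ []
      w₂≢[] refl = x∉X (subst (_∈ X) (sym ends₂) z∈X)

      x∉w₂ : x ∉ₗ targets w₂
      x∉w₂ = proj₂ (proj₂ disjoint) (subst (x ∈ₗ_) (sym (targets-++ w₁ ((e , x) ∷ []))) (∈-++⁺ʳ (targets w₁) (here refl)))

      z∉w₁′ : z ∉ₗ targets w₁′
      z∉w₁′ z∈ = proj₂ (proj₂ disjoint) z∈ (subst (_∈ₗ targets w₂) ends₂ (endpoint∈targets x w₂ w₂≢[]))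

      x-balanced : x ∈ B → inF e + inFᵐ (firstEdge w₂) ≡ 1
      x-balanced x∈B with unique w₁ e x w₂ split w₂≢[]
      ... | x∉₁ , x∉₂ = trans (sym (trans (degF≡fdeg Q steps x edges-enum)
                                      (trans (cong (fdeg x) split) (fdeg-inner z w₁ e x w₂ (subst (IsWalk z) split isWalk) x∉₁ x∉₂))))
                          (bal x (SetP.x∈p∩q⁺ (x∈Q , SetP.x∉p⇒x∈∁p x∉X)) x∈B)

      forward : (x ∈ B → inFᵐ (firstEdge w₂) ≡ 1) → Approach (V Q) x
      forward first∈F =
        approach-along {Q} z∈X Q∩X⊆z Q∩V₀-empty w₂ w₂≢[] (subst (λ q → IsWalk q w₂) (endpoint-snoc z w₁ e x) (proj₂ walks)) ends₂
          (subst Nodup (sym (verts≡∷targets x w₂)) (x∉w₂ , proj₁ (proj₂ disjoint)))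
          (subst (λ q → Balanced (_∈ B) q w₂) (endpoint-snoc z w₁ e x) (proj₁ (proj₂ bals))) first∈F
          (λ v v∈ → verts⁻ v (subst (v ∈ₗ_) (cong (verts z) (sym split′))
                     (suffix-⊆verts z w₁′ w₂ (subst (λ q → v ∈ₗ verts q w₂) (sym (endpoint-snoc z w₁ e x)) v∈))))

      backward : inF e ≡ 1 → Approach (V Q) x
      backward e∈F = subst (Approach (V Q)) (endpoint-snoc z w₁ e x)
        (approach-along {Q} z∈X Q∩X⊆z Q∩V₀-empty (reverse z w₁′) (reverse≢[] z w₁′ (snoc≢[] w₁ (e , x)))
          (isWalk-reverse z w₁′ (proj₁ walks)) (endpoint-reverse z w₁′)
          (subst Nodup (sym (verts-reverse z w₁′))
            (nodup-reverse (verts z w₁′) (subst Nodup (sym (verts≡∷targets z w₁′)) (z∉w₁′ , proj₁ disjoint))))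
          (balanced-reverse (_∈ B) z w₁′ (proj₁ bals))
          (λ _ → trans (cong inFᵐ (trans (firstEdge-reverse z w₁′) (lastEdge-snoc w₁ e x))) e∈F)
          (λ v v∈ → verts⁻ v (subst (v ∈ₗ_) (cong (verts z) (sym split′)) (subst (v ∈ₗ_) (sym (verts-++ z w₁′ w₂))
                     (∈-++⁺ˡ {xs = verts z w₁′} (AnyP.reverse⁻ {xs = verts z w₁′} (subst (v ∈ₗ_) (verts-reverse z w₁′) v∈)))))))

      approach : Approach (V Q) x
      approach with x ∈? B
      ... | no x∉B  = forward (λ x∈B → ⊥-elim (x∉B x∈B))
      ... | yes x∈B with inFᵐ-cases (firstEdge w₂)
      ... | inj₁ next∈F = forward (λ _ → next∈F)
      ... | inj₂ next∉F = backward (trans (sym (ℕP.+-identityʳ (inF e)))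
                                     (trans (cong (λ k → inF e + k) (sym next∉F)) (x-balanced x∈B)))

    approach : ∀ x → x ∈ V Q → x ∉ X → Approach (V Q) x
    approach x x∈Q x∉X with ∈-targets⇒split steps (closed-verts⊆targets z steps nonempty closed (verts⁺ x x∈Q))
    ... | _ , _ , _ , split = Leaving.approach x∈Q x∉X split

lemma11p13 : (G : Graph) (T A B : Subset (n G)) → IsComb G T A B →
    (F : Subset (m G)) → MinJoin G T F →
    (V₀ : Subset (n G)) → IsFactorComponent G T V₀ →
    (X : Subset (n G)) (P : Sub G) → Guide G B F V₀ X P →
    (Q : Sub G) → EffBalancedEar G A B F X Q →
    (∀ v → v ∈ V Q → v ∉ V₀) →
    Guide G B F V₀ (X ∪ V Q) P
lemma11p13 G T A B comb F mj V₀ fc X P gd@(_ , ear , bonds⊆B∩V₀ , necks∉F , int⊆X , _) Q eff Q∩V₀-empty =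
  X∪Q∩V₀-empty , ear , bonds⊆B∩V₀ , necks∉F , (λ x∈ → SetP.x∈p∪q⁺ (inj₁ (int⊆X x∈))) , guidePaths
  where
  open GuideExtension G comb mj fc gd
  X∪Q∩V₀-empty : ∀ x → x ∈ X ∪ V Q → x ∉ V₀
  X∪Q∩V₀-empty x x∈ = [ X∩V₀-empty x , Q∩V₀-empty x ] (SetP.x∈p∪q⁻ X (V Q) x∈)
  approach : ∀ x → x ∈ V Q → x ∉ X → Approach (V Q) x
  approach with proj₂ eff
  ... | inj₁ (circuit , _ , z , z∈Q , X⇔z) = Round.approach circuit z∈Q X⇔z (proj₂ (proj₁ eff)) Q∩V₀-empty
  ... | inj₂ (s , t , (path , has-edge , t∈X , Q∩X⊆t) , F-avoids-removed , matched) =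
    Straight.approach path has-edge t∈X Q∩X⊆t Q∩V₀-empty F-avoids-removed matched
  guidePaths : ∀ x → x ∈ X ∪ V Q → GuidePath (X ∪ V Q) x
  guidePaths x x∈ with x ∈? X | SetP.x∈p∪q⁻ X (V Q) x∈
  ... | yes x∈X | _        = guidePath-mono (λ v∈ → SetP.x∈p∪q⁺ (inj₁ v∈)) (guidePath x x∈X)
  ... | no x∉X  | inj₁ x∈X = ⊥-elim (x∉X x∈X)
  ... | no x∉X  | inj₂ x∈Q = extend (approach x x∈Q x∉X)
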